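{- Let $\mathbb{F}_q$ be a finite field with $q$ elements, let $n>1$, $1\le d<n$ be integers, and let $\alpha\in\mathbb{F}_{q^n}$ be a root of an irreducible polynomial of degree $n$ over $\mathbb{F}_q$. Let $N_d(n,q,\alpha)$ be the number of connected components of $G_d(n,q,\alpha)$. Then $$N_d(n,q,\alpha)\leq \frac{q^n-1}{\binom{|P_d|+1}{\lceil n/d\rceil-1}}.$$
   Context: A polynomial of positive degree is primary if it is a power of an irreducible polynomial. $P_d$ is the set of monic primary polynomials of degree $d$ in $\mathbb{F}_q[x]$ and $|P_d|$ its cardinality; $E_d=\{g(\alpha): g\in P_d\}$. $G_d(n,q,\alpha)$ is the directed Cayley graph with vertex set $\mathbb{F}_{q^n}^*$ and edges $\beta_1\to\beta_2$ whenever $\beta_2/\beta_1\in E_d$; its connected components are the cosets of the subgroup generated by $E_d$. -}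

module Defs where

open import Level using (Level; _⊔_)
open import Data.Nat using (ℕ; zero; suc; _≤_; _/_)
import Data.Nat as ℕ
open import Data.Fin using (Fin)
open import Data.Product using (Σ; ∃; _×_; _,_)
open import Data.List using (List; []; _∷_; map; length; _++_)
open import Data.List.Relation.Binary.Pointwise using (Pointwise)
open import Data.List.Relation.Unary.All using (All)
open import Data.List.Relation.Unary.Any using (Any)
open import Data.List.Relation.Unary.AllPairs using (AllPairs)
open import Data.Vec using (Vec; toList)
open import Relation.Nullary using (¬_)
open import Relation.Binary.PropositionalEquality using (_≡_)
import Relation.Binary.PropositionalEquality as ≡
open import Relation.Binary.Construct.Closure.Equivalence using (EqClosure)
open import Data.Sum using (_⊎_)
open import Algebra.Bundles using (CommutativeRing)
open import Algebra.Morphism.Structures using (module RingMorphisms)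
open import Function.Bundles using (Inverse)

-- ⌈ n / d ⌉ for natural numbers (value 0 when d = 0, never used then)

ceilDiv : ℕ → ℕ → ℕ
ceilDiv n zero    = 0
ceilDiv n (suc k) = (n ℕ.+ k) / suc k

module _ {c ℓ : Level} (R : CommutativeRing c ℓ) where
  open CommutativeRing R

  IsField : Set (c ⊔ ℓ)
  IsField = (1# ≉ 0#) × (∀ x → x ≉ 0# → ∃ λ y → x * y ≈ 1#)

  HasSize : ℕ → Set (c ⊔ ℓ)
  HasSize k = Inverse setoid (≡.setoid (Fin k))

-- Polynomials over F: coefficient lists, lowest degree first

module Poly {c ℓ : Level} (F : CommutativeRing c ℓ) where
  open CommutativeRing F

  Pol : Set c
  Pol = List Carrier

  _≋_ : Pol → Pol → Set (c ⊔ ℓ)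
  _≋_ = Pointwise _≈_

  _+ₚ_ : Pol → Pol → Pol
  []       +ₚ q        = q
  (a ∷ p)  +ₚ []       = a ∷ p
  (a ∷ p)  +ₚ (b ∷ q)  = (a + b) ∷ (p +ₚ q)

  _*ₚ_ : Pol → Pol → Pol
  []      *ₚ q = []
  (a ∷ p) *ₚ q = map (a *_) q +ₚ (0# ∷ (p *ₚ q))

  _^ₚ_ : Pol → ℕ → Pol
  p ^ₚ zero  = 1# ∷ []
  p ^ₚ suc k = p *ₚ (p ^ₚ k)

  monic : ∀ {d} → Vec Carrier d → Pol
  monic v = toList v ++ (1# ∷ [])

  Irreducible : ∀ {d} → Vec Carrier d → Set (c ⊔ ℓ)
  Irreducible {d} f =
    (1 ≤ d) ×
    (∀ a b (u : Vec Carrier a) (w : Vec Carrier b) → 1 ≤ a → 1 ≤ b →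
       ¬ ((monic u *ₚ monic w) ≋ monic f))

  Primary : ∀ {d} → Vec Carrier d → Set (c ⊔ ℓ)
  Primary f = ∃ λ e → Σ (Vec Carrier e) λ g → Irreducible g ×
                (∃ λ k → (1 ≤ k) × ((monic g ^ₚ k) ≋ monic f))

  CardP : ℕ → ℕ → Set (c ⊔ ℓ)
  CardP d m = ∃ λ (L : List (Vec Carrier d)) →
    (length L ≡ m) × All Primary L ×
    AllPairs (λ u v → ¬ (monic u ≋ monic v)) L ×
    (∀ (v : Vec Carrier d) → Primary v → Any (λ u → monic v ≋ monic u) L)

module Ext {c ℓ c' ℓ' : Level}
           (F : CommutativeRing c ℓ) (K : CommutativeRing c' ℓ')
           (ι : CommutativeRing.Carrier F → CommutativeRing.Carrier K) where
  open Poly F public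
  module F = CommutativeRing F
  module K = CommutativeRing K

  eval : Pol → K.Carrier → K.Carrier
  eval []      x = K.0#
  eval (a ∷ p) x = ι a K.+ (x K.* eval p x)

  RootOfIrreducible : ℕ → K.Carrier → Set (c ⊔ ℓ ⊔ ℓ')
  RootOfIrreducible n α =
    Σ (Vec F.Carrier n) λ f → Irreducible f × (eval (monic f) α K.≈ K.0#)

  Edge : ℕ → K.Carrier → K.Carrier → K.Carrier → Set (c ⊔ ℓ ⊔ ℓ')
  Edge d α β₁ β₂ = (β₁ K.≉ K.0#) × (β₂ K.≉ K.0#) ×
    (Σ (Vec F.Carrier d) λ g → Primary g × (β₂ K.≈ β₁ K.* eval (monic g) α))

  -- lying in the same connected component (vertices taken up to ≈)
  Connected : ℕ → K.Carrier → K.Carrier → K.Carrier → Set (c ⊔ c' ⊔ ℓ ⊔ ℓ')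
  Connected d α = EqClosure (λ x y → Edge d α x y ⊎ (x K.≈ y))

  NumComponents : ℕ → K.Carrier → ℕ → Set (c ⊔ c' ⊔ ℓ ⊔ ℓ')
  NumComponents d α N = ∃ λ (L : List K.Carrier) →
    (length L ≡ N) × All (λ β → β K.≉ K.0#) L ×
    AllPairs (λ β γ → ¬ Connected d α β γ) L ×
    (∀ β → β K.≉ K.0# → Any (Connected d α β) L)

-- Multiplying β by g(α), for g a product of distinct elements of P_d, stays inside the
-- component of β.  With at most k = ⌈n/d⌉ − 1 factors such products have degree < n,
-- and the values g(α) are then nonzero and pairwise distinct: a nonzero polynomial of
-- degree < n does not vanish at α, and products of distinct primary polynomials differ
-- by unique factorisation.  Both facts come from one descent: an ideal containing an
-- irreducible monic h and a nonzero polynomial of smaller degree contains a nonzero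
-- constant.  Such products are indexed by the k-subsets of |P_d| + 1 elements, so each
-- of the N components has at least C(|P_d| + 1, k) of the q^n − 1 nonzero elements.

module Submission where

open import Level using (Level; _⊔_)
open import Function using (_∘_)
open import Function.Bundles using (Inverse; Injection)
open import Function.Properties.Inverse using (Inverse⇒Injection)
open import Data.Empty using (⊥-elim)
open import Data.Product using (∃; ∃₂; _×_; _,_; proj₁; proj₂; uncurry)
open import Data.Sum using (_⊎_; inj₁; inj₂; [_,_]′)
open import Data.Maybe using (nothing)
open import Data.Nat as ℕ using (ℕ; zero; suc; z≤n; s≤s; _<_; _≤_; _∸_)
import Data.Nat.Properties as ℕₚ
open import Data.Nat.DivMod using (m/n*n≤m)
open import Data.Nat.Combinatorics using (_C_; nCk+nC[k+1]≡[n+1]C[k+1])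
open import Data.Nat.Induction using (<-rec)
open import Data.Fin as Fin using (Fin; splitAt; join; punchOut; remQuot; combine)
open import Data.Fin.Properties using (join-splitAt; punchOut-injective; injective⇒≤; combine-remQuot)
open import Data.Fin.Subset using (Subset; inside; outside; ∣_∣; ⊥)
open import Data.Fin.Subset.Properties using (∣⊥∣≡0; ∣p∣≤∣x∷p∣)
open import Data.List as List using (List; []; _∷_; map; length; _++_)
open import Data.List.Properties using (length-map)
open import Data.List.Membership.Propositional.Properties using (∈-lookup)
open import Data.List.Relation.Binary.Pointwise using ([]; _∷_)
open import Data.List.Relation.Unary.All as All using (All; []; _∷_; lookupAny)
open import Data.List.Relation.Unary.Any using (Any; here; there)
open import Data.List.Relation.Unary.AllPairs using (AllPairs; []; _∷_)
open import Data.Vec as Vec using (Vec; []; _∷_; toList; initLast)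
open import Data.Vec.Properties using (toList-∷ʳ; length-toList; ∷-injectiveˡ; ∷-injectiveʳ)
open import Relation.Nullary using (¬_; Dec; yes; no)
open import Relation.Nullary.Decidable using (via-injection)
open import Relation.Binary.Bundles using (Setoid)
open import Relation.Binary.Definitions using (tri<; tri≈; tri>)
open import Relation.Binary.PropositionalEquality as ≡ using (_≡_; _≢_)
open import Relation.Binary.Construct.Closure.Symmetric using (fwd)
open import Relation.Binary.Construct.Closure.ReflexiveTransitive using (ε; _◅_; _◅◅_)
import Relation.Binary.Construct.Closure.Equivalence as EqClosure
open import Algebra.Bundles using (CommutativeRing)
open import Algebra.Morphism.Structures using (module RingMorphisms)
open import Tactic.RingSolver.Core.AlmostCommutativeRing using (fromCommutativeRing)
open import Defs

module PolynomialArithmetic {c ℓ : Level} (F : CommutativeRing c ℓ) where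
  open CommutativeRing F hiding (zero)
  open Poly F
  open import Relation.Binary.Reasoning.Setoid setoid
  open import Tactic.RingSolver.NonReflective (fromCommutativeRing F (λ _ → nothing))
    using (solve; _⊜_) renaming (_⊕_ to _⊕'_; _⊗_ to _⊗'_)
  open import Algebra.Properties.Ring ring using (-1*x≈-x; xyx⁻¹≈y; x∙y⁻¹≈ε⇒x≈y)

  coeff : Pol → ℕ → Carrier
  coeff []      _       = 0#
  coeff (a ∷ p) zero    = a
  coeff (a ∷ p) (suc i) = coeff p i

  -- Unlike _≋_, this equality ignores trailing zero coefficients.
  infix 4 _≈ₚ_
  record _≈ₚ_ (p q : Pol) : Set ℓ where
    constructor coeffwise
    field coeff-≈ : ∀ i → coeff p i ≈ coeff q i
  open _≈ₚ_ public

  ≈ₚ-refl : ∀ {p} → p ≈ₚ p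
  ≈ₚ-refl = coeffwise λ _ → refl

  ≈ₚ-sym : ∀ {p q} → p ≈ₚ q → q ≈ₚ p
  ≈ₚ-sym e = coeffwise λ i → sym (coeff-≈ e i)

  ≈ₚ-trans : ∀ {p q r} → p ≈ₚ q → q ≈ₚ r → p ≈ₚ r
  ≈ₚ-trans e f = coeffwise λ i → trans (coeff-≈ e i) (coeff-≈ f i)

  ∷-cong : ∀ {a b p q} → a ≈ b → p ≈ₚ q → (a ∷ p) ≈ₚ (b ∷ q)
  ∷-cong e f = coeffwise λ { zero → e ; (suc i) → coeff-≈ f i }

  ≈ₚ-setoid : Setoid c ℓ
  ≈ₚ-setoid = record
    { Carrier = Pol
    ; _≈_ = _≈ₚ_
    ; isEquivalence = record { refl = ≈ₚ-refl ; sym = ≈ₚ-sym ; trans = ≈ₚ-trans }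
    }

  scale : Carrier → Pol → Pol
  scale a = map (a *_)

  -ₚ_ : Pol → Pol
  -ₚ p = scale (- 1#) p

  coeff-+ₚ : ∀ p q i → coeff (p +ₚ q) i ≈ coeff p i + coeff q i
  coeff-+ₚ []      q       i       = sym (+-identityˡ _)
  coeff-+ₚ (a ∷ p) []      i       = sym (+-identityʳ _)
  coeff-+ₚ (a ∷ p) (b ∷ q) zero    = refl
  coeff-+ₚ (a ∷ p) (b ∷ q) (suc i) = coeff-+ₚ p q i

  coeff-scale : ∀ a p i → coeff (scale a p) i ≈ a * coeff p i
  coeff-scale a []      i       = sym (zeroʳ a)
  coeff-scale a (b ∷ p) zero    = refl
  coeff-scale a (b ∷ p) (suc i) = coeff-scale a p i

  coeff-negₚ : ∀ p i → coeff (-ₚ p) i ≈ - coeff p i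
  coeff-negₚ p i = trans (coeff-scale (- 1#) p i) (-1*x≈-x _)

  coeff-*ₚ : ∀ a p q i → coeff ((a ∷ p) *ₚ q) i ≈ a * coeff q i + coeff (0# ∷ (p *ₚ q)) i
  coeff-*ₚ a p q i = trans (coeff-+ₚ (scale a q) (0# ∷ (p *ₚ q)) i) (+-congʳ (coeff-scale a q i))

  coeff-shift-+ₚ : ∀ r s i → coeff (0# ∷ (r +ₚ s)) i ≈ coeff (0# ∷ r) i + coeff (0# ∷ s) i
  coeff-shift-+ₚ r s zero    = sym (+-identityˡ _)
  coeff-shift-+ₚ r s (suc i) = coeff-+ₚ r s i

  +ₚ-cong : ∀ {p p' q q'} → p ≈ₚ p' → q ≈ₚ q' → (p +ₚ q) ≈ₚ (p' +ₚ q')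
  +ₚ-cong {p} {p'} {q} {q'} e f = coeffwise λ i →
    trans (coeff-+ₚ p q i) (trans (+-cong (coeff-≈ e i) (coeff-≈ f i)) (sym (coeff-+ₚ p' q' i)))

  +ₚ-assoc : ∀ p q r → ((p +ₚ q) +ₚ r) ≈ₚ (p +ₚ (q +ₚ r))
  +ₚ-assoc p q r = coeffwise λ i → begin
    coeff ((p +ₚ q) +ₚ r) i             ≈⟨ coeff-+ₚ (p +ₚ q) r i ⟩
    coeff (p +ₚ q) i + coeff r i        ≈⟨ +-congʳ (coeff-+ₚ p q i) ⟩
    (coeff p i + coeff q i) + coeff r i ≈⟨ +-assoc _ _ _ ⟩
    coeff p i + (coeff q i + coeff r i) ≈⟨ +-congˡ (coeff-+ₚ q r i) ⟨
    coeff p i + coeff (q +ₚ r) i        ≈⟨ coeff-+ₚ p (q +ₚ r) i ⟨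
    coeff (p +ₚ (q +ₚ r)) i             ∎

  +ₚ-identityʳ : ∀ p → (p +ₚ []) ≈ₚ p
  +ₚ-identityʳ []      = ≈ₚ-refl
  +ₚ-identityʳ (a ∷ p) = ≈ₚ-refl

  +ₚ-≈[]ʳ : ∀ p {q} → q ≈ₚ [] → (p +ₚ q) ≈ₚ p
  +ₚ-≈[]ʳ p q≈[] = ≈ₚ-trans (+ₚ-cong (≈ₚ-refl {p}) q≈[]) (+ₚ-identityʳ p)

  +ₚ-inverseʳ : ∀ p → (p +ₚ (-ₚ p)) ≈ₚ []
  +ₚ-inverseʳ p = coeffwise λ i → begin
    coeff (p +ₚ (-ₚ p)) i                ≈⟨ coeff-+ₚ p (-ₚ p) i ⟩
    coeff p i + coeff (-ₚ p) i           ≈⟨ +-congˡ (coeff-negₚ p i) ⟩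
    coeff p i - coeff p i                ≈⟨ -‿inverseʳ _ ⟩
    0#                                   ∎

  scale-cong : ∀ {a b p q} → a ≈ b → p ≈ₚ q → scale a p ≈ₚ scale b q
  scale-cong {a} {b} {p} {q} e f = coeffwise λ i →
    trans (coeff-scale a p i) (trans (*-cong e (coeff-≈ f i)) (sym (coeff-scale b q i)))

  scale-scale : ∀ a b p → scale a (scale b p) ≈ₚ scale (a * b) p
  scale-scale a b p = coeffwise λ i → begin
    coeff (scale a (scale b p)) i ≈⟨ coeff-scale a (scale b p) i ⟩
    a * coeff (scale b p) i       ≈⟨ *-congˡ (coeff-scale b p i) ⟩
    a * (b * coeff p i)           ≈⟨ *-assoc _ _ _ ⟨
    (a * b) * coeff p i           ≈⟨ coeff-scale (a * b) p i ⟨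
    coeff (scale (a * b) p) i     ∎

  scale-identity : ∀ p → scale 1# p ≈ₚ p
  scale-identity p = coeffwise λ i → trans (coeff-scale 1# p i) (*-identityˡ _)

  *ₚ-congʳ : ∀ p {q q'} → q ≈ₚ q' → (p *ₚ q) ≈ₚ (p *ₚ q')
  *ₚ-congʳ []      e = ≈ₚ-refl
  *ₚ-congʳ (a ∷ p) {q} {q'} e = coeffwise λ i → begin
    coeff ((a ∷ p) *ₚ q) i                   ≈⟨ coeff-*ₚ a p q i ⟩
    a * coeff q i + coeff (0# ∷ (p *ₚ q)) i   ≈⟨ +-cong (*-congˡ (coeff-≈ e i))
                                                       (coeff-≈ (∷-cong refl (*ₚ-congʳ p e)) i) ⟩
    a * coeff q' i + coeff (0# ∷ (p *ₚ q')) i ≈⟨ coeff-*ₚ a p q' i ⟨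
    coeff ((a ∷ p) *ₚ q') i                  ∎

  *ₚ-zeroʳ : ∀ q → (q *ₚ []) ≈ₚ []
  *ₚ-zeroʳ []      = ≈ₚ-refl
  *ₚ-zeroʳ (a ∷ q) = coeffwise λ { zero → refl ; (suc i) → coeff-≈ (*ₚ-zeroʳ q) i }

  *ₚ-∷ʳ : ∀ p b q → (p *ₚ (b ∷ q)) ≈ₚ (scale b p +ₚ (0# ∷ (p *ₚ q)))
  *ₚ-∷ʳ []      b q = coeffwise λ { zero → refl ; (suc i) → refl }
  *ₚ-∷ʳ (a ∷ p) b q = coeffwise λ
    { zero → trans (coeff-*ₚ a p (b ∷ q) zero)
               (trans (+-congʳ (*-comm a b)) (sym (coeff-+ₚ (scale b (a ∷ p)) (0# ∷ ((a ∷ p) *ₚ q)) zero)))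
    ; (suc i) → begin
      coeff ((a ∷ p) *ₚ (b ∷ q)) (suc i)                               ≈⟨ coeff-*ₚ a p (b ∷ q) (suc i) ⟩
      a * coeff q i + coeff (p *ₚ (b ∷ q)) i                           ≈⟨ +-congˡ (coeff-≈ (*ₚ-∷ʳ p b q) i) ⟩
      a * coeff q i + coeff (scale b p +ₚ (0# ∷ (p *ₚ q))) i           ≈⟨ +-congˡ (coeff-+ₚ (scale b p) _ i) ⟩
      a * coeff q i + (coeff (scale b p) i + coeff (0# ∷ (p *ₚ q)) i) ≈⟨ swap _ _ _ ⟩
      coeff (scale b p) i + (a * coeff q i + coeff (0# ∷ (p *ₚ q)) i) ≈⟨ +-congˡ (coeff-*ₚ a p q i) ⟨
      coeff (scale b p) i + coeff ((a ∷ p) *ₚ q) i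
        ≈⟨ coeff-+ₚ (scale b (a ∷ p)) (0# ∷ ((a ∷ p) *ₚ q)) (suc i) ⟨
      coeff (scale b (a ∷ p) +ₚ (0# ∷ ((a ∷ p) *ₚ q))) (suc i)         ∎ }
    where
    swap : ∀ x y z → x + (y + z) ≈ y + (x + z)
    swap = solve 3 (λ x y z → (x ⊕' (y ⊕' z)) ⊜ (y ⊕' (x ⊕' z))) refl

  *ₚ-comm : ∀ p q → (p *ₚ q) ≈ₚ (q *ₚ p)
  *ₚ-comm []      q = ≈ₚ-sym (*ₚ-zeroʳ q)
  *ₚ-comm (a ∷ p) q = coeffwise λ i → begin
    coeff ((a ∷ p) *ₚ q) i                          ≈⟨ coeff-+ₚ (scale a q) (0# ∷ (p *ₚ q)) i ⟩
    coeff (scale a q) i + coeff (0# ∷ (p *ₚ q)) i   ≈⟨ +-congˡ (coeff-≈ (∷-cong refl (*ₚ-comm p q)) i) ⟩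
    coeff (scale a q) i + coeff (0# ∷ (q *ₚ p)) i   ≈⟨ coeff-+ₚ (scale a q) (0# ∷ (q *ₚ p)) i ⟨
    coeff (scale a q +ₚ (0# ∷ (q *ₚ p))) i          ≈⟨ coeff-≈ (*ₚ-∷ʳ q a p) i ⟨
    coeff (q *ₚ (a ∷ p)) i                          ∎

  *ₚ-congˡ : ∀ {p p'} q → p ≈ₚ p' → (p *ₚ q) ≈ₚ (p' *ₚ q)
  *ₚ-congˡ {p} {p'} q e = ≈ₚ-trans (*ₚ-comm p q) (≈ₚ-trans (*ₚ-congʳ q e) (*ₚ-comm q p'))

  *ₚ-cong : ∀ {p p' q q'} → p ≈ₚ p' → q ≈ₚ q' → (p *ₚ q) ≈ₚ (p' *ₚ q')
  *ₚ-cong {p' = p'} {q} e f = ≈ₚ-trans (*ₚ-congˡ q e) (*ₚ-congʳ p' f)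

  *ₚ-distribˡ : ∀ p q r → (p *ₚ (q +ₚ r)) ≈ₚ ((p *ₚ q) +ₚ (p *ₚ r))
  *ₚ-distribˡ []      q r = ≈ₚ-refl
  *ₚ-distribˡ (a ∷ p) q r = coeffwise λ i → begin
    coeff ((a ∷ p) *ₚ (q +ₚ r)) i
      ≈⟨ coeff-*ₚ a p (q +ₚ r) i ⟩
    a * coeff (q +ₚ r) i + coeff (0# ∷ (p *ₚ (q +ₚ r))) i
      ≈⟨ +-cong (*-congˡ (coeff-+ₚ q r i)) (coeff-≈ (∷-cong refl (*ₚ-distribˡ p q r)) i) ⟩
    a * (coeff q i + coeff r i) + coeff (0# ∷ ((p *ₚ q) +ₚ (p *ₚ r))) i
      ≈⟨ +-congˡ (coeff-shift-+ₚ (p *ₚ q) (p *ₚ r) i) ⟩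
    a * (coeff q i + coeff r i) + (coeff (0# ∷ (p *ₚ q)) i + coeff (0# ∷ (p *ₚ r)) i)
      ≈⟨ distrib4 _ _ _ _ _ ⟩
    (a * coeff q i + coeff (0# ∷ (p *ₚ q)) i) + (a * coeff r i + coeff (0# ∷ (p *ₚ r)) i)
      ≈⟨ +-cong (coeff-*ₚ a p q i) (coeff-*ₚ a p r i) ⟨
    coeff ((a ∷ p) *ₚ q) i + coeff ((a ∷ p) *ₚ r) i
      ≈⟨ coeff-+ₚ ((a ∷ p) *ₚ q) ((a ∷ p) *ₚ r) i ⟨
    coeff (((a ∷ p) *ₚ q) +ₚ ((a ∷ p) *ₚ r)) i ∎
    where
    distrib4 : ∀ a x y u v → a * (x + y) + (u + v) ≈ (a * x + u) + (a * y + v)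
    distrib4 = solve 5 (λ a x y u v → (a ⊗' (x ⊕' y) ⊕' (u ⊕' v)) ⊜ ((a ⊗' x ⊕' u) ⊕' (a ⊗' y ⊕' v))) refl

  *ₚ-distribʳ : ∀ p q r → ((q +ₚ r) *ₚ p) ≈ₚ ((q *ₚ p) +ₚ (r *ₚ p))
  *ₚ-distribʳ p q r = ≈ₚ-trans (*ₚ-comm (q +ₚ r) p)
    (≈ₚ-trans (*ₚ-distribˡ p q r) (+ₚ-cong (*ₚ-comm p q) (*ₚ-comm p r)))

  shift-*ₚ : ∀ s r → ((0# ∷ s) *ₚ r) ≈ₚ (0# ∷ (s *ₚ r))
  shift-*ₚ s r = coeffwise λ i → trans (coeff-*ₚ 0# s r i) (trans (+-congʳ (zeroˡ _)) (+-identityˡ _))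

  scale-*ₚ : ∀ a q r → (scale a q *ₚ r) ≈ₚ scale a (q *ₚ r)
  scale-*ₚ a []      r = ≈ₚ-refl
  scale-*ₚ a (b ∷ q) r = coeffwise λ i → begin
    coeff ((a * b ∷ scale a q) *ₚ r) i                     ≈⟨ coeff-*ₚ (a * b) (scale a q) r i ⟩
    (a * b) * coeff r i + coeff (0# ∷ (scale a q *ₚ r)) i   ≈⟨ +-congˡ (coeff-≈ (∷-cong refl (scale-*ₚ a q r)) i) ⟩
    (a * b) * coeff r i + coeff (0# ∷ scale a (q *ₚ r)) i   ≈⟨ +-cong (*-assoc _ _ _) (shifted i) ⟩
    a * (b * coeff r i) + a * coeff (0# ∷ (q *ₚ r)) i       ≈⟨ distribˡ _ _ _ ⟨
    a * (b * coeff r i + coeff (0# ∷ (q *ₚ r)) i)           ≈⟨ *-congˡ (coeff-*ₚ b q r i) ⟨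
    a * coeff ((b ∷ q) *ₚ r) i                             ≈⟨ coeff-scale a ((b ∷ q) *ₚ r) i ⟨
    coeff (scale a ((b ∷ q) *ₚ r)) i                       ∎
    where
    shifted : ∀ i → coeff (0# ∷ scale a (q *ₚ r)) i ≈ a * coeff (0# ∷ (q *ₚ r)) i
    shifted zero    = sym (zeroʳ a)
    shifted (suc i) = coeff-scale a (q *ₚ r) i

  *ₚ-scale : ∀ a p q → (p *ₚ scale a q) ≈ₚ scale a (p *ₚ q)
  *ₚ-scale a p q = ≈ₚ-trans (*ₚ-comm p (scale a q))
    (≈ₚ-trans (scale-*ₚ a q p) (scale-cong refl (*ₚ-comm q p)))

  *ₚ-assoc : ∀ p q r → ((p *ₚ q) *ₚ r) ≈ₚ (p *ₚ (q *ₚ r))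
  *ₚ-assoc []      q r = ≈ₚ-refl
  *ₚ-assoc (a ∷ p) q r = ≈ₚ-trans (*ₚ-distribʳ r (scale a q) (0# ∷ (p *ₚ q)))
    (+ₚ-cong (scale-*ₚ a q r) (≈ₚ-trans (shift-*ₚ (p *ₚ q) r) (∷-cong refl (*ₚ-assoc p q r))))

  const-*ₚ : ∀ a q → ((a ∷ []) *ₚ q) ≈ₚ scale a q
  const-*ₚ a q = coeffwise λ i → begin
    coeff ((a ∷ []) *ₚ q) i                 ≈⟨ coeff-*ₚ a [] q i ⟩
    a * coeff q i + coeff (0# ∷ []) i       ≈⟨ +-congˡ (zero-const i) ⟩
    a * coeff q i + 0#                      ≈⟨ +-identityʳ _ ⟩
    a * coeff q i                           ≈⟨ coeff-scale a q i ⟨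
    coeff (scale a q) i                     ∎
    where
    zero-const : ∀ i → coeff (0# ∷ []) i ≈ 0#
    zero-const zero    = refl
    zero-const (suc i) = refl

  *ₚ-identityˡ : ∀ q → ((1# ∷ []) *ₚ q) ≈ₚ q
  *ₚ-identityˡ q = ≈ₚ-trans (const-*ₚ 1# q) (scale-identity q)

  *ₚ-identityʳ : ∀ q → (q *ₚ (1# ∷ [])) ≈ₚ q
  *ₚ-identityʳ q = ≈ₚ-trans (*ₚ-comm q (1# ∷ [])) (*ₚ-identityˡ q)

  ^ₚ-cong : ∀ {p p'} k → p ≈ₚ p' → (p ^ₚ k) ≈ₚ (p' ^ₚ k)
  ^ₚ-cong zero    e = ≈ₚ-refl
  ^ₚ-cong (suc k) e = *ₚ-cong e (^ₚ-cong k e)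

  ≈ₚ-moveˡ : ∀ {p r q} → p ≈ₚ (r +ₚ q) → q ≈ₚ (p +ₚ (-ₚ r))
  ≈ₚ-moveˡ {p} {r} {q} e = coeffwise λ i → begin
    coeff q i                            ≈⟨ xyx⁻¹≈y (coeff r i) (coeff q i) ⟨
    coeff r i + coeff q i - coeff r i    ≈⟨ +-cong (sym (coeff-+ₚ r q i)) (sym (coeff-negₚ r i)) ⟩
    coeff (r +ₚ q) i + coeff (-ₚ r) i    ≈⟨ +-congʳ (coeff-≈ e i) ⟨
    coeff p i + coeff (-ₚ r) i           ≈⟨ coeff-+ₚ p (-ₚ r) i ⟨
    coeff (p +ₚ (-ₚ r)) i                ∎

  ≈ₚ-from-difference : ∀ {p q} → (p +ₚ (-ₚ q)) ≈ₚ [] → p ≈ₚ q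
  ≈ₚ-from-difference {p} {q} z = coeffwise λ i → x∙y⁻¹≈ε⇒x≈y _ _ (begin
    coeff p i - coeff q i                ≈⟨ +-congˡ (coeff-negₚ q i) ⟨
    coeff p i + coeff (-ₚ q) i           ≈⟨ coeff-+ₚ p (-ₚ q) i ⟨
    coeff (p +ₚ (-ₚ q)) i                ≈⟨ coeff-≈ z i ⟩
    0#                                   ∎)

  length-+ₚ : ∀ p q → length (p +ₚ q) ≡ length p ℕ.⊔ length q
  length-+ₚ []      q       = ≡.refl
  length-+ₚ (a ∷ p) []      = ≡.refl
  length-+ₚ (a ∷ p) (b ∷ q) = ≡.cong suc (length-+ₚ p q)

  length-scale : ∀ a p → length (scale a p) ≡ length p
  length-scale a p = length-map (a *_) p

  length-*ₚ : ∀ a p b q → length ((a ∷ p) *ₚ (b ∷ q)) ≡ suc (length p ℕ.+ length q)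
  length-*ₚ a []       b q = ≡.cong suc
    (≡.trans (length-+ₚ (scale a q) []) (≡.trans (ℕₚ.⊔-identityʳ _) (length-scale a q)))
  length-*ₚ a (a' ∷ p) b q = ≡.cong suc (≡.trans (length-+ₚ (scale a q) ((a' ∷ p) *ₚ (b ∷ q)))
    (≡.trans (≡.cong₂ ℕ._⊔_ (length-scale a q) (length-*ₚ a' p b q))
      (ℕₚ.m≤n⇒m⊔n≡n (ℕₚ.≤-trans (ℕₚ.m≤n+m (length q) (length p)) (ℕₚ.n≤1+n _)))))

  length-monic : ∀ {e} (v : Vec Carrier e) → length (monic v) ≡ suc e
  length-monic []      = ≡.refl
  length-monic (x ∷ v) = ≡.cong suc (length-monic v)

  length-monic-*ₚ : ∀ {a b} (u : Vec Carrier a) (w : Vec Carrier b) → length (monic u *ₚ monic w) ≡ suc (a ℕ.+ b)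
  length-monic-*ₚ {a} {b} u w = nonEmpty (monic u) (monic w) (length-monic u) (length-monic w)
    where
    nonEmpty : ∀ p q → length p ≡ suc a → length q ≡ suc b → length (p *ₚ q) ≡ suc (a ℕ.+ b)
    nonEmpty (x ∷ p) (y ∷ q) ≡.refl ≡.refl = length-*ₚ x p y q

  ≈ₚ⇒≋ : ∀ {p q} → length p ≡ length q → p ≈ₚ q → p ≋ q
  ≈ₚ⇒≋ {[]}    {[]}    _  _   = []
  ≈ₚ⇒≋ {a ∷ p} {b ∷ q} eq p≈q =
    coeff-≈ p≈q 0 ∷ ≈ₚ⇒≋ (ℕₚ.suc-injective eq) (coeffwise λ i → coeff-≈ p≈q (suc i))

  ≋⇒≈ₚ : ∀ {p q} → p ≋ q → p ≈ₚ q
  ≋⇒≈ₚ []          = ≈ₚ-refl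
  ≋⇒≈ₚ (a≈b ∷ p≋q) = ∷-cong a≈b (≋⇒≈ₚ p≋q)

  selectedProduct : ∀ {d} (L : List (Vec Carrier d)) → Subset (length L) → Pol
  selectedProduct []      []            = 1# ∷ []
  selectedProduct (g ∷ L) (inside ∷ s)  = monic g *ₚ selectedProduct L s
  selectedProduct (g ∷ L) (outside ∷ s) = selectedProduct L s

module PolynomialIdeals {c ℓ : Level} (F : CommutativeRing c ℓ) where
  open CommutativeRing F hiding (zero)
  open Poly F
  open PolynomialArithmetic F
  open import Relation.Binary.Reasoning.Setoid ≈ₚ-setoid

  infix 4 _∣ₚ_
  record _∣ₚ_ (h p : Pol) : Set (c ⊔ ℓ) where
    constructor divides
    field
      quotient : Pol
      equation : p ≈ₚ (h *ₚ quotient)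

  record IsIdeal {i} (I : Pol → Set i) : Set (c ⊔ ℓ ⊔ i) where
    field
      ≈ₚ-closed : ∀ {p q} → p ≈ₚ q → I p → I q
      +ₚ-closed : ∀ {p q} → I p → I q → I (p +ₚ q)
      *ₚ-closed : ∀ a {p} → I p → I (a *ₚ p)

    scale-closed : ∀ a {p} → I p → I (scale a p)
    scale-closed a Ip = ≈ₚ-closed (const-*ₚ a _) (*ₚ-closed (a ∷ []) Ip)

    *ₚ-closedʳ : ∀ {p} a → I p → I (p *ₚ a)
    *ₚ-closedʳ {p} a Ip = ≈ₚ-closed (*ₚ-comm a p) (*ₚ-closed a Ip)

    difference-closed : ∀ {p q} → I p → I q → I (p +ₚ (-ₚ q))
    difference-closed Ip Iq = +ₚ-closed Ip (scale-closed (- 1#) Iq)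

  ∣ₚ-isIdeal : ∀ h → IsIdeal (h ∣ₚ_)
  ∣ₚ-isIdeal h = record
    { ≈ₚ-closed = λ p≈q (divides w p≈hw) → divides w (≈ₚ-trans (≈ₚ-sym p≈q) p≈hw)
    ; +ₚ-closed = λ (divides w p≈hw) (divides w' q≈hw') →
        divides (w +ₚ w') (≈ₚ-trans (+ₚ-cong p≈hw q≈hw') (≈ₚ-sym (*ₚ-distribˡ h w w')))
    ; *ₚ-closed = λ a {p} (divides w p≈hw) → divides (a *ₚ w) (begin
        a *ₚ p          ≈⟨ *ₚ-congʳ a p≈hw ⟩
        a *ₚ (h *ₚ w)   ≈⟨ *ₚ-assoc a h w ⟨
        (a *ₚ h) *ₚ w   ≈⟨ *ₚ-congˡ w (*ₚ-comm a h) ⟩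
        (h *ₚ a) *ₚ w   ≈⟨ *ₚ-assoc h a w ⟩
        h *ₚ (a *ₚ w)   ∎)
    }

  ∣ₚ-trans : ∀ {h g p} → h ∣ₚ g → g ∣ₚ p → h ∣ₚ p
  ∣ₚ-trans {h} h∣g (divides w p≈gw) = ≈ₚ-closed (≈ₚ-sym p≈gw) (*ₚ-closedʳ w h∣g)
    where open IsIdeal (∣ₚ-isIdeal h)

  *ₚ-preimage-isIdeal : ∀ {i} {I : Pol → Set i} → IsIdeal I → ∀ b → IsIdeal (λ p → I (p *ₚ b))
  *ₚ-preimage-isIdeal I-ideal b = record
    { ≈ₚ-closed = λ p≈q → ≈ₚ-closed (*ₚ-congˡ b p≈q)
    ; +ₚ-closed = λ {p} {q} Ipb Iqb → ≈ₚ-closed (≈ₚ-sym (*ₚ-distribʳ b p q)) (+ₚ-closed Ipb Iqb)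
    ; *ₚ-closed = λ a {p} Ipb → ≈ₚ-closed (≈ₚ-sym (*ₚ-assoc a p b)) (*ₚ-closed a Ipb)
    }
    where open IsIdeal I-ideal

module FieldProperties {c ℓ : Level} (R : CommutativeRing c ℓ) (isField : IsField R) where
  open CommutativeRing R
  open import Relation.Binary.Reasoning.Setoid setoid

  1≉0 : 1# ≉ 0#
  1≉0 = proj₁ isField

  *-cancelˡ-≉0 : ∀ {x y z} → x ≉ 0# → x * y ≈ x * z → y ≈ z
  *-cancelˡ-≉0 {x} {y} {z} x≉0 e with proj₂ isField x x≉0
  ... | (x⁻¹ , xx⁻¹≈1) = begin
    y                ≈⟨ left-inverse y ⟨
    x⁻¹ * (x * y)    ≈⟨ *-congˡ e ⟩
    x⁻¹ * (x * z)    ≈⟨ left-inverse z ⟩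
    z                ∎
    where
    left-inverse : ∀ w → x⁻¹ * (x * w) ≈ w
    left-inverse w = begin
      x⁻¹ * (x * w)  ≈⟨ *-assoc _ _ _ ⟨
      (x⁻¹ * x) * w  ≈⟨ *-congʳ (trans (*-comm x⁻¹ x) xx⁻¹≈1) ⟩
      1# * w         ≈⟨ *-identityˡ w ⟩
      w              ∎

  *-≉0 : ∀ {x y} → x ≉ 0# → y ≉ 0# → x * y ≉ 0#
  *-≉0 {x} {y} x≉0 y≉0 xy≈0 = y≉0 (*-cancelˡ-≉0 x≉0 (trans xy≈0 (sym (zeroʳ x))))

module PolynomialsOverField {c ℓ : Level} (F : CommutativeRing c ℓ) (isField : IsField F)
                            (_≈0? : ∀ x → Dec (CommutativeRing._≈_ F x (CommutativeRing.0# F))) where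
  open CommutativeRing F hiding (zero)
  open Poly F
  open PolynomialArithmetic F
  open PolynomialIdeals F
  open FieldProperties F isField
  open import Algebra.Properties.Ring ring using (xyx⁻¹≈y)

  -- Read as "p has degree e and leading coefficient l" when l ≉ 0#.
  record LeadingTerm (p : Pol) (e : ℕ) (l : Carrier) : Set ℓ where
    constructor leadingTerm
    field
      coeff-leading : coeff p e ≈ l
      coeff-above   : ∀ i → e < i → coeff p i ≈ 0#
  open LeadingTerm public

  NonZeroₚ : Pol → Set (c ⊔ ℓ)
  NonZeroₚ p = ∃₂ λ e l → l ≉ 0# × LeadingTerm p e l

  DegreeBelow : ℕ → Pol → Set ℓ
  DegreeBelow n p = ∀ i → n ≤ i → coeff p i ≈ 0#

  ≈ₚ[]⊎NonZeroₚ : ∀ p → p ≈ₚ [] ⊎ NonZeroₚ p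
  ≈ₚ[]⊎NonZeroₚ []      = inj₁ ≈ₚ-refl
  ≈ₚ[]⊎NonZeroₚ (a ∷ p) with ≈ₚ[]⊎NonZeroₚ p
  ... | inj₂ (e , l , l≉0 , leadingTerm le above) =
    inj₂ (suc e , l , l≉0 , leadingTerm le λ { (suc i) (s≤s e<i) → above i e<i })
  ... | inj₁ p≈[] with a ≈0?
  ...   | yes a≈0 = inj₁ (coeffwise λ { zero → a≈0 ; (suc i) → coeff-≈ p≈[] i })
  ...   | no a≉0  = inj₂ (0 , a , a≉0 , leadingTerm refl λ { (suc i) _ → coeff-≈ p≈[] i })

  NonZeroₚ⇒≉ₚ[] : ∀ {p} → NonZeroₚ p → ¬ p ≈ₚ []
  NonZeroₚ⇒≉ₚ[] (e , l , l≉0 , L) p≈[] = l≉0 (trans (sym (coeff-leading L)) (coeff-≈ p≈[] e))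

  LeadingTerm-cong : ∀ {p q e l} → p ≈ₚ q → LeadingTerm p e l → LeadingTerm q e l
  LeadingTerm-cong {e = e} p≈q (leadingTerm le above) =
    leadingTerm (trans (sym (coeff-≈ p≈q e)) le) (λ i e<i → trans (sym (coeff-≈ p≈q i)) (above i e<i))

  LeadingTerm-≈ : ∀ {p e l l'} → l ≈ l' → LeadingTerm p e l → LeadingTerm p e l'
  LeadingTerm-≈ l≈l' (leadingTerm le above) = leadingTerm (trans le l≈l') above

  leadingCoeff-unique : ∀ {p e l l'} → LeadingTerm p e l → LeadingTerm p e l' → l ≈ l'
  leadingCoeff-unique L L' = trans (sym (coeff-leading L)) (coeff-leading L')

  degree-unique : ∀ {p e e' l l'} → l ≉ 0# → l' ≉ 0# → LeadingTerm p e l → LeadingTerm p e' l' → e ≡ e'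
  degree-unique {e = e} {e'} l≉0 l'≉0 L L' with ℕₚ.<-cmp e e'
  ... | tri< e<e' _ _ = ⊥-elim (l'≉0 (trans (sym (coeff-leading L')) (coeff-above L e' e<e')))
  ... | tri≈ _ e≡e' _ = e≡e'
  ... | tri> _ _ e'<e = ⊥-elim (l≉0 (trans (sym (coeff-leading L)) (coeff-above L' e e'<e)))

  degree<⇒DegreeBelow : ∀ {p e l n} → e < n → LeadingTerm p e l → DegreeBelow n p
  degree<⇒DegreeBelow e<n L i n≤i = coeff-above L i (ℕₚ.<-≤-trans e<n n≤i)

  DegreeBelow⇒degree< : ∀ {p e l n} → l ≉ 0# → LeadingTerm p e l → DegreeBelow n p → e < n
  DegreeBelow⇒degree< {e = e} {n = n} l≉0 L below with ℕₚ.<-cmp e n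
  ... | tri< e<n _ _ = e<n
  ... | tri≈ _ e≡n _ = ⊥-elim (l≉0 (trans (sym (coeff-leading L)) (below e (ℕₚ.≤-reflexive (≡.sym e≡n)))))
  ... | tri> _ _ n<e = ⊥-elim (l≉0 (trans (sym (coeff-leading L)) (below e (ℕₚ.<⇒≤ n<e))))

  DegreeBelow-length : ∀ p → DegreeBelow (length p) p
  DegreeBelow-length []      i       _         = refl
  DegreeBelow-length (a ∷ p) (suc i) (s≤s n≤i) = DegreeBelow-length p i n≤i

  DegreeBelow-+ₚ : ∀ {n p q} → DegreeBelow n p → DegreeBelow n q → DegreeBelow n (p +ₚ q)
  DegreeBelow-+ₚ {p = p} {q} below below' i n≤i =
    trans (coeff-+ₚ p q i) (trans (+-cong (below i n≤i) (below' i n≤i)) (+-identityˡ 0#))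

  DegreeBelow-negₚ : ∀ {n p} → DegreeBelow n p → DegreeBelow n (-ₚ p)
  DegreeBelow-negₚ {p = p} below i n≤i = trans (coeff-scale (- 1#) p i) (trans (*-congˡ (below i n≤i)) (zeroʳ _))

  *ₚ-leadingTerm : ∀ {p q e e' l l'} → LeadingTerm p e l → LeadingTerm q e' l' →
                   LeadingTerm (p *ₚ q) (e ℕ.+ e') (l * l')
  *ₚ-leadingTerm {[]} {q} {e} {e'} L L' = leadingTerm
    (trans (sym (zeroˡ _)) (*-congʳ (coeff-leading L))) (λ _ _ → refl)
  *ₚ-leadingTerm {a ∷ p} {q} {zero} {e'} {l} {l'} L L' = leadingTerm
    (begin
      coeff ((a ∷ p) *ₚ q) e'                   ≈⟨ coeff-*ₚ a p q e' ⟩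
      a * coeff q e' + coeff (0# ∷ (p *ₚ q)) e' ≈⟨ +-cong (*-cong (coeff-leading L) (coeff-leading L')) (shifted e') ⟩
      l * l' + 0#                               ≈⟨ +-identityʳ _ ⟩
      l * l'                                    ∎)
    (λ i e'<i → begin
      coeff ((a ∷ p) *ₚ q) i                    ≈⟨ coeff-*ₚ a p q i ⟩
      a * coeff q i + coeff (0# ∷ (p *ₚ q)) i   ≈⟨ +-cong (*-congˡ (coeff-above L' i e'<i)) (shifted i) ⟩
      a * 0# + 0#                               ≈⟨ +-identityʳ _ ⟩
      a * 0#                                    ≈⟨ zeroʳ a ⟩
      0#                                        ∎)
    where
    open import Relation.Binary.Reasoning.Setoid setoid
    p≈[] : p ≈ₚ []
    p≈[] = coeffwise λ i → coeff-above L (suc i) (s≤s z≤n)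
    shifted : ∀ i → coeff (0# ∷ (p *ₚ q)) i ≈ 0#
    shifted zero    = refl
    shifted (suc i) = coeff-≈ (*ₚ-congˡ q p≈[]) i
  *ₚ-leadingTerm {a ∷ p} {q} {suc e} {e'} {l} {l'} L L' = leadingTerm
    (begin
      coeff ((a ∷ p) *ₚ q) (suc (e ℕ.+ e'))       ≈⟨ coeff-*ₚ a p q (suc (e ℕ.+ e')) ⟩
      a * coeff q (suc (e ℕ.+ e')) + coeff (p *ₚ q) (e ℕ.+ e')
        ≈⟨ +-cong (trans (*-congˡ (coeff-above L' _ (s≤s (ℕₚ.m≤n+m e' e)))) (zeroʳ a)) (coeff-leading IH) ⟩
      0# + l * l'                               ≈⟨ +-identityˡ _ ⟩
      l * l'                                    ∎)
    (λ { (suc i) (s≤s e+e'<i) → begin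
      coeff ((a ∷ p) *ₚ q) (suc i)              ≈⟨ coeff-*ₚ a p q (suc i) ⟩
      a * coeff q (suc i) + coeff (p *ₚ q) i
        ≈⟨ +-cong (trans (*-congˡ (coeff-above L' _ (s≤s (ℕₚ.≤-trans (ℕₚ.m≤n+m e' e) (ℕₚ.<⇒≤ e+e'<i))))) (zeroʳ a))
                  (coeff-above IH i e+e'<i) ⟩
      0# + 0#                                   ≈⟨ +-identityˡ _ ⟩
      0#                                        ∎ })
    where
    open import Relation.Binary.Reasoning.Setoid setoid
    IH : LeadingTerm (p *ₚ q) (e ℕ.+ e') (l * l')
    IH = *ₚ-leadingTerm {p} (leadingTerm (coeff-leading L) λ i e<i → coeff-above L (suc i) (s≤s e<i)) L'

  NonZeroₚ-*ₚ : ∀ {p q} → NonZeroₚ p → NonZeroₚ q → NonZeroₚ (p *ₚ q)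
  NonZeroₚ-*ₚ (e , l , l≉0 , L) (e' , l' , l'≉0 , L') = e ℕ.+ e' , l * l' , *-≉0 l≉0 l'≉0 , *ₚ-leadingTerm L L'

  *ₚ-cancelˡ : ∀ {p q r} → NonZeroₚ p → (p *ₚ q) ≈ₚ (p *ₚ r) → q ≈ₚ r
  *ₚ-cancelˡ {p} {q} {r} p≉0 pq≈pr with ≈ₚ[]⊎NonZeroₚ (q +ₚ (-ₚ r))
  ... | inj₁ q-r≈0  = ≈ₚ-from-difference q-r≈0
  ... | inj₂ q-r≉0  = ⊥-elim (NonZeroₚ⇒≉ₚ[] (NonZeroₚ-*ₚ p≉0 q-r≉0) (begin
    p *ₚ (q +ₚ (-ₚ r))          ≈⟨ *ₚ-distribˡ p q (-ₚ r) ⟩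
    (p *ₚ q) +ₚ (p *ₚ (-ₚ r))   ≈⟨ +ₚ-cong pq≈pr (*ₚ-scale (- 1#) p r) ⟩
    (p *ₚ r) +ₚ (-ₚ (p *ₚ r))   ≈⟨ +ₚ-inverseʳ (p *ₚ r) ⟩
    []                          ∎))
    where open import Relation.Binary.Reasoning.Setoid ≈ₚ-setoid

  monic-leadingTerm : ∀ {e} (v : Vec Carrier e) → LeadingTerm (monic v) e 1#
  monic-leadingTerm []      = leadingTerm refl λ { (suc i) _ → refl }
  monic-leadingTerm (x ∷ v) = leadingTerm (coeff-leading L) λ { (suc i) (s≤s e<i) → coeff-above L i e<i }
    where
    L : LeadingTerm (monic v) _ 1#
    L = monic-leadingTerm v

  monic-NonZeroₚ : ∀ {e} (v : Vec Carrier e) → NonZeroₚ (monic v)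
  monic-NonZeroₚ v = _ , 1# , 1≉0 , monic-leadingTerm v

  const-leadingTerm : ∀ a → LeadingTerm (a ∷ []) 0 a
  const-leadingTerm a = leadingTerm refl λ { (suc i) _ → refl }

  const-NonZeroₚ : ∀ {a} → a ≉ 0# → NonZeroₚ (a ∷ [])
  const-NonZeroₚ a≉0 = 0 , _ , a≉0 , const-leadingTerm _

  degree0⇒≈ₚconst : ∀ {p l} → LeadingTerm p 0 l → p ≈ₚ (l ∷ [])
  degree0⇒≈ₚconst L = coeffwise λ
    { zero → coeff-leading L ; (suc i) → coeff-above L (suc i) (s≤s z≤n) }

  ^ₚ-leadingTerm : ∀ {p e} k → LeadingTerm p e 1# → LeadingTerm (p ^ₚ k) (k ℕ.* e) 1#
  ^ₚ-leadingTerm zero    L = const-leadingTerm 1#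
  ^ₚ-leadingTerm (suc k) L = LeadingTerm-≈ (*-identityˡ 1#) (*ₚ-leadingTerm L (^ₚ-leadingTerm k L))

  scale-leadingTerm : ∀ {p e l} a → LeadingTerm p e l → LeadingTerm (scale a p) e (a * l)
  scale-leadingTerm {p} {e} a L = leadingTerm (trans (coeff-scale a p e) (*-congˡ (coeff-leading L)))
    (λ i e<i → trans (coeff-scale a p i) (trans (*-congˡ (coeff-above L i e<i)) (zeroʳ a)))

  lowerCoeffs : Pol → (j : ℕ) → Vec Carrier j
  lowerCoeffs p       zero    = []
  lowerCoeffs []      (suc j) = 0# ∷ lowerCoeffs [] j
  lowerCoeffs (a ∷ p) (suc j) = a ∷ lowerCoeffs p j

  leading1⇒≈ₚmonic : ∀ {p} j → LeadingTerm p j 1# → p ≈ₚ monic (lowerCoeffs p j)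
  leading1⇒≈ₚmonic {[]}    j       L = ⊥-elim (1≉0 (sym (coeff-leading L)))
  leading1⇒≈ₚmonic {a ∷ p} zero    L = coeffwise λ
    { zero → coeff-leading L ; (suc i) → coeff-above L (suc i) (s≤s z≤n) }
  leading1⇒≈ₚmonic {a ∷ p} (suc j) L = ∷-cong refl
    (leading1⇒≈ₚmonic j (leadingTerm (coeff-leading L) λ i j<i → coeff-above L (suc i) (s≤s j<i)))

  IsIdeal-scale-cancel : ∀ {i} {I : Pol → Set i} → IsIdeal I → ∀ {a p} → a ≉ 0# → I (scale a p) → I p
  IsIdeal-scale-cancel I-ideal {a} {p} a≉0 Iap with proj₂ isField a a≉0
  ... | (a⁻¹ , aa⁻¹≈1) = ≈ₚ-closed (begin
    scale a⁻¹ (scale a p)  ≈⟨ scale-scale a⁻¹ a p ⟩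
    scale (a⁻¹ * a) p      ≈⟨ scale-cong (trans (*-comm a⁻¹ a) aa⁻¹≈1) ≈ₚ-refl ⟩
    scale 1# p             ≈⟨ scale-identity p ⟩
    p                      ∎) (scale-closed a⁻¹ Iap)
    where
    open IsIdeal I-ideal
    open import Relation.Binary.Reasoning.Setoid ≈ₚ-setoid

  split-monic : ∀ {e} a (u m : Vec Carrier e) →
    (toList u ++ (a ∷ [])) ≈ₚ (scale a (monic m) +ₚ toList (Vec.zipWith (λ x y → x - a * y) u m))
  split-monic a []      []      = coeffwise λ { zero → sym (*-identityʳ a) ; (suc i) → refl }
  split-monic a (x ∷ u) (y ∷ m) = ∷-cong (sym (begin
    a * y + (x - a * y)   ≈⟨ +-assoc _ _ _ ⟨
    (a * y + x) - a * y   ≈⟨ xyx⁻¹≈y _ _ ⟩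
    x                     ∎)) (split-monic a u m)
    where open import Relation.Binary.Reasoning.Setoid setoid

  divMod : ∀ {e} (m : Vec Carrier e) p → ∃₂ λ Q (r : Vec Carrier e) → p ≈ₚ ((Q *ₚ monic m) +ₚ toList r)
  divMod {e} m []      = [] , Vec.replicate e 0# , ≈ₚ-sym (coeffwise (zeros e))
    where
    zeros : ∀ e i → coeff (toList (Vec.replicate e 0#)) i ≈ 0#
    zeros zero    i       = refl
    zeros (suc e) zero    = refl
    zeros (suc e) (suc i) = zeros e i
  divMod {e} m (a ∷ p) with divMod m p
  ... | Q' , r' , p≈Q'm+r' with initLast (a ∷ r')
  ...   | u , b , ar'≡u∷ʳb = (0# ∷ Q') +ₚ (b ∷ []) , r , (begin
    a ∷ p                                           ≈⟨ ∷-cong (sym (+-identityˡ a)) p≈Q'm+r' ⟩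
    (0# ∷ (Q' *ₚ monic m)) +ₚ (a ∷ toList r')        ≈⟨ +ₚ-cong (≈ₚ-sym (shift-*ₚ Q' (monic m))) lowest ⟩
    ((0# ∷ Q') *ₚ monic m) +ₚ (scale b (monic m) +ₚ toList r)
      ≈⟨ +ₚ-assoc ((0# ∷ Q') *ₚ monic m) (scale b (monic m)) (toList r) ⟨
    (((0# ∷ Q') *ₚ monic m) +ₚ scale b (monic m)) +ₚ toList r
      ≈⟨ +ₚ-cong (+ₚ-cong (≈ₚ-refl {(0# ∷ Q') *ₚ monic m}) (≈ₚ-sym (const-*ₚ b (monic m))))
                 (≈ₚ-refl {toList r}) ⟩
    (((0# ∷ Q') *ₚ monic m) +ₚ ((b ∷ []) *ₚ monic m)) +ₚ toList r
      ≈⟨ +ₚ-cong (≈ₚ-sym (*ₚ-distribʳ (monic m) (0# ∷ Q') (b ∷ []))) ≈ₚ-refl ⟩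
    (((0# ∷ Q') +ₚ (b ∷ [])) *ₚ monic m) +ₚ toList r ∎)
    where
    open import Relation.Binary.Reasoning.Setoid ≈ₚ-setoid
    r : Vec Carrier e
    r = Vec.zipWith (λ x y → x - b * y) u m
    lowest : (a ∷ toList r') ≈ₚ (scale b (monic m) +ₚ toList r)
    lowest = ≡.subst (_≈ₚ (scale b (monic m) +ₚ toList r))
      (≡.sym (≡.trans (≡.cong toList ar'≡u∷ʳb) (toList-∷ʳ b u))) (split-monic b u m)

  monic-∤-lowerDegree : ∀ {e r} (h : Vec Carrier e) → NonZeroₚ r → DegreeBelow e r → ¬ monic h ∣ₚ r
  monic-∤-lowerDegree {e} h r≉0@(e' , l , l≉0 , L) below (divides w r≈hw) with ≈ₚ[]⊎NonZeroₚ w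
  ... | inj₁ w≈[] =
    NonZeroₚ⇒≉ₚ[] r≉0 (≈ₚ-trans r≈hw (≈ₚ-trans (*ₚ-congʳ (monic h) w≈[]) (*ₚ-zeroʳ (monic h))))
  ... | inj₂ (j , lw , lw≉0 , Lw) = ℕₚ.<-irrefl ≡.refl (ℕₚ.<-≤-trans e+j<e (ℕₚ.m≤m+n e j))
    where
    e+j<e : e ℕ.+ j < e
    e+j<e = DegreeBelow⇒degree< (*-≉0 1≉0 lw≉0)
      (LeadingTerm-cong (≈ₚ-sym r≈hw) (*ₚ-leadingTerm (monic-leadingTerm h) Lw)) below

  monic-∤-1 : ∀ {e} (h : Vec Carrier e) → 1 ≤ e → ¬ monic h ∣ₚ (1# ∷ [])
  monic-∤-1 h 1≤e = monic-∤-lowerDegree h (const-NonZeroₚ 1≉0) (degree<⇒DegreeBelow 1≤e (const-leadingTerm 1#))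

  selectedProduct-leadingTerm : ∀ {d} (L : List (Vec Carrier d)) s →
                                LeadingTerm (selectedProduct L s) (∣ s ∣ ℕ.* d) 1#
  selectedProduct-leadingTerm []      []            = const-leadingTerm 1#
  selectedProduct-leadingTerm (g ∷ L) (inside ∷ s)  =
    LeadingTerm-≈ (*-identityˡ 1#) (*ₚ-leadingTerm (monic-leadingTerm g) (selectedProduct-leadingTerm L s))
  selectedProduct-leadingTerm (g ∷ L) (outside ∷ s) = selectedProduct-leadingTerm L s

  remainder-DegreeBelow : ∀ {e} (r : Vec Carrier e) → DegreeBelow e (toList r)
  remainder-DegreeBelow r = ≡.subst (λ k → DegreeBelow k (toList r)) (length-toList r) (DegreeBelow-length (toList r))

module IrreduciblePolynomials {c ℓ : Level} (F : CommutativeRing c ℓ) (isField : IsField F)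
                              (_≈0? : ∀ x → Dec (CommutativeRing._≈_ F x (CommutativeRing.0# F))) where
  open CommutativeRing F hiding (zero)
  open Poly F
  open PolynomialArithmetic F
  open PolynomialIdeals F
  open FieldProperties F isField
  open PolynomialsOverField F isField _≈0?

  module _ {e} {h : Vec Carrier e} (h-irreducible : Irreducible h) where

    irreducible-¬monicFactor : ∀ {e'} (m : Vec Carrier e') → 1 ≤ e' → e' < e →
                               ∀ Q → ¬ monic h ≈ₚ (Q *ₚ monic m)
    irreducible-¬monicFactor m 1≤e' e'<e Q h≈Qm with ≈ₚ[]⊎NonZeroₚ Q
    ... | inj₁ Q≈[] = NonZeroₚ⇒≉ₚ[] (monic-NonZeroₚ h) (≈ₚ-trans h≈Qm (*ₚ-congˡ (monic m) Q≈[]))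
    ... | inj₂ (j , lq , lq≉0 , LQ) =
      proj₂ h-irreducible j _ (lowerCoeffs Q j) m (positive j j+e'≡e) 1≤e' (≈ₚ⇒≋ lengths product≈h)
      where
      L-Qm : LeadingTerm (Q *ₚ monic m) (j ℕ.+ _) (lq * 1#)
      L-Qm = *ₚ-leadingTerm LQ (monic-leadingTerm m)
      L-h : LeadingTerm (Q *ₚ monic m) e 1#
      L-h = LeadingTerm-cong h≈Qm (monic-leadingTerm h)
      j+e'≡e : j ℕ.+ _ ≡ e
      j+e'≡e = degree-unique (*-≉0 lq≉0 1≉0) 1≉0 L-Qm L-h
      lq≈1 : lq ≈ 1#
      lq≈1 = trans (sym (*-identityʳ lq))
        (leadingCoeff-unique L-Qm (≡.subst (λ k → LeadingTerm _ k 1#) (≡.sym j+e'≡e) L-h))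
      positive : ∀ j → j ℕ.+ _ ≡ e → 1 ≤ j
      positive zero    e'≡e = ⊥-elim (ℕₚ.<-irrefl e'≡e e'<e)
      positive (suc j) _    = s≤s z≤n
      product≈h : (monic (lowerCoeffs Q j) *ₚ monic m) ≈ₚ monic h
      product≈h = ≈ₚ-trans (*ₚ-congˡ (monic m) (≈ₚ-sym (leading1⇒≈ₚmonic j (LeadingTerm-≈ lq≈1 LQ))))
                           (≈ₚ-sym h≈Qm)
      lengths : length (monic (lowerCoeffs Q j) *ₚ monic m) ≡ length (monic h)
      lengths = ≡.trans (length-monic-*ₚ (lowerCoeffs Q j) m) (≡.trans (≡.cong suc j+e'≡e) (≡.sym (length-monic h)))

    -- Euclid's algorithm run inside I: dividing h by the monic multiple of r
    -- leaves a remainder in I of smaller degree, nonzero as h is irreducible.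
    module _ {i} {I : Pol → Set i} (I-ideal : IsIdeal I) (I-h : I (monic h)) where
      open IsIdeal I-ideal

      lowerDegree⇒nonzeroConstant : ∀ {r e' l} → l ≉ 0# → LeadingTerm r e' l → e' < e → I r →
                                    ∃ λ a → a ≉ 0# × I (a ∷ [])
      lowerDegree⇒nonzeroConstant {e' = e'} = <-rec Goal descend e'
        where
        Goal : ℕ → Set _
        Goal e' = ∀ {r l} → l ≉ 0# → LeadingTerm r e' l → e' < e → I r → ∃ λ a → a ≉ 0# × I (a ∷ [])

        descend : ∀ e' → (∀ {e₂} → e₂ < e' → Goal e₂) → Goal e'
        descend zero     _   l≉0 L _ Ir = _ , l≉0 , ≈ₚ-closed (degree0⇒≈ₚconst L) Ir
        descend (suc e₀) rec {r} {l} l≉0 L e'<e Ir = reduce (divMod m (monic h))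
          where
          l⁻¹ : Carrier
          l⁻¹ = proj₁ (proj₂ isField l l≉0)
          L' : LeadingTerm (scale l⁻¹ r) (suc e₀) 1#
          L' = LeadingTerm-≈ (trans (*-comm l⁻¹ l) (proj₂ (proj₂ isField l l≉0))) (scale-leadingTerm l⁻¹ L)
          m : Vec Carrier (suc e₀)
          m = lowerCoeffs (scale l⁻¹ r) (suc e₀)
          I-m : I (monic m)
          I-m = ≈ₚ-closed (leading1⇒≈ₚmonic (suc e₀) L') (scale-closed l⁻¹ Ir)
          reduce : (∃₂ λ Q r₂ → monic h ≈ₚ ((Q *ₚ monic m) +ₚ toList r₂)) → ∃ λ a → a ≉ 0# × I (a ∷ [])
          reduce (Q , r₂ , h≈Qm+r₂) with ≈ₚ[]⊎NonZeroₚ (toList r₂)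
          ... | inj₁ r₂≈[] = ⊥-elim (irreducible-¬monicFactor m (s≤s z≤n) e'<e Q
                  (≈ₚ-trans h≈Qm+r₂ (+ₚ-≈[]ʳ (Q *ₚ monic m) r₂≈[])))
          ... | inj₂ (e₂ , l₂ , l₂≉0 , L₂) = rec e₂<e' l₂≉0 L₂ (ℕₚ.<-trans e₂<e' e'<e)
                  (≈ₚ-closed (≈ₚ-sym (≈ₚ-moveˡ h≈Qm+r₂)) (difference-closed I-h (*ₚ-closed Q I-m)))
            where
            e₂<e' : e₂ < suc e₀
            e₂<e' = DegreeBelow⇒degree< l₂≉0 L₂ (remainder-DegreeBelow r₂)

    irreducible-prime : ∀ a b → monic h ∣ₚ (a *ₚ b) → monic h ∣ₚ a ⊎ monic h ∣ₚ b
    irreducible-prime a b h∣ab = cases (divMod h a)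
      where
      h∣-ideal : IsIdeal (monic h ∣ₚ_)
      h∣-ideal = ∣ₚ-isIdeal (monic h)
      h∣·b-ideal : IsIdeal (λ p → monic h ∣ₚ (p *ₚ b))
      h∣·b-ideal = *ₚ-preimage-isIdeal h∣-ideal b
      open IsIdeal h∣·b-ideal

      h∣hb : monic h ∣ₚ (monic h *ₚ b)
      h∣hb = divides b ≈ₚ-refl

      cancelConstant : (∃ λ c → c ≉ 0# × monic h ∣ₚ ((c ∷ []) *ₚ b)) → monic h ∣ₚ b
      cancelConstant (c , c≉0 , h∣cb) =
        IsIdeal-scale-cancel h∣-ideal c≉0 (IsIdeal.≈ₚ-closed h∣-ideal (const-*ₚ c b) h∣cb)

      cases : (∃₂ λ Q r → a ≈ₚ ((Q *ₚ monic h) +ₚ toList r)) → monic h ∣ₚ a ⊎ monic h ∣ₚ b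
      cases (Q , r , a≈Qh+r) with ≈ₚ[]⊎NonZeroₚ (toList r)
      ... | inj₁ r≈[] =
        inj₁ (divides Q (≈ₚ-trans a≈Qh+r (≈ₚ-trans (+ₚ-≈[]ʳ (Q *ₚ monic h) r≈[]) (*ₚ-comm Q (monic h)))))
      ... | inj₂ (e' , l , l≉0 , L) = inj₂ (cancelConstant
              (lowerDegree⇒nonzeroConstant h∣·b-ideal h∣hb l≉0 L
                (DegreeBelow⇒degree< l≉0 L (remainder-DegreeBelow r))
                (≈ₚ-closed {q = toList r} (≈ₚ-sym (≈ₚ-moveˡ a≈Qh+r))
                  (difference-closed {a} {Q *ₚ monic h} h∣ab (*ₚ-closed Q {monic h} h∣hb)))))

  irreducible-∣-^ₚ : ∀ {e} {h : Vec Carrier e} → Irreducible h → ∀ p k → monic h ∣ₚ (p ^ₚ k) → monic h ∣ₚ p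
  irreducible-∣-^ₚ {h = h} h-irr p zero    h∣1      = ⊥-elim (monic-∤-1 h (proj₁ h-irr) h∣1)
  irreducible-∣-^ₚ h-irr p (suc k) h∣pp^k with irreducible-prime h-irr p (p ^ₚ k) h∣pp^k
  ... | inj₁ h∣p   = h∣p
  ... | inj₂ h∣p^k = irreducible-∣-^ₚ h-irr p k h∣p^k

  irreducible-∣-irreducible : ∀ {e e'} {h : Vec Carrier e} {h' : Vec Carrier e'} →
                              Irreducible h → Irreducible h' → monic h ∣ₚ monic h' → monic h ≈ₚ monic h'
  irreducible-∣-irreducible {e} {e'} {h} {h'} h-irr h'-irr (divides w h'≈hw) with ≈ₚ[]⊎NonZeroₚ w
  ... | inj₁ w≈[] = ⊥-elim (NonZeroₚ⇒≉ₚ[] (monic-NonZeroₚ h')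
          (≈ₚ-trans h'≈hw (≈ₚ-trans (*ₚ-congʳ (monic h) w≈[]) (*ₚ-zeroʳ (monic h)))))
  ... | inj₂ (j , lw , lw≉0 , Lw) = conclude j e+j≡e' Lw
    where
    L-hw : LeadingTerm (monic h *ₚ w) (e ℕ.+ j) (1# * lw)
    L-hw = *ₚ-leadingTerm (monic-leadingTerm h) Lw
    L-h' : LeadingTerm (monic h *ₚ w) e' 1#
    L-h' = LeadingTerm-cong h'≈hw (monic-leadingTerm h')
    e+j≡e' : e ℕ.+ j ≡ e'
    e+j≡e' = degree-unique (*-≉0 1≉0 lw≉0) 1≉0 L-hw L-h'
    conclude : ∀ j → e ℕ.+ j ≡ e' → LeadingTerm w j lw → monic h ≈ₚ monic h'
    conclude zero _ Lw' = begin
      monic h               ≈⟨ *ₚ-identityʳ (monic h) ⟨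
      monic h *ₚ (1# ∷ [])  ≈⟨ *ₚ-congʳ (monic h) w≈1 ⟨
      monic h *ₚ w          ≈⟨ h'≈hw ⟨
      monic h'              ∎
      where
      open import Relation.Binary.Reasoning.Setoid ≈ₚ-setoid
      lw≈1 : lw ≈ 1#
      lw≈1 = trans (sym (*-identityˡ lw))
        (leadingCoeff-unique L-hw (≡.subst (λ k → LeadingTerm _ k 1#) (≡.sym e+j≡e') L-h'))
      w≈1 : w ≈ₚ (1# ∷ [])
      w≈1 = ≈ₚ-trans (degree0⇒≈ₚconst Lw') (∷-cong lw≈1 ≈ₚ-refl)
    conclude (suc j) e+1+j≡e' _ = ⊥-elim (irreducible-¬monicFactor h'-irr h (proj₁ h-irr) e<e' w
                                     (≈ₚ-trans h'≈hw (*ₚ-comm (monic h) w)))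
      where
      e<e' : e < e'
      e<e' = ≡.subst (e <_) e+1+j≡e' (ℕₚ.m<m+n e (s≤s z≤n))

  monic-power-degree : ∀ {d e k} {g : Vec Carrier d} {h : Vec Carrier e} → (monic h ^ₚ k) ≋ monic g → k ℕ.* e ≡ d
  monic-power-degree {k = k} {g} {h} h^k≋g =
    degree-unique 1≉0 1≉0 (LeadingTerm-cong (≋⇒≈ₚ h^k≋g) (^ₚ-leadingTerm k (monic-leadingTerm h))) (monic-leadingTerm g)

  primaries-sharing-factor-≋ : ∀ {d e k} {g g' : Vec Carrier d} {h : Vec Carrier e} → Irreducible h →
                               (monic h ^ₚ k) ≋ monic g → Primary g' → monic h ∣ₚ monic g' → monic g ≋ monic g'
  primaries-sharing-factor-≋ {d} {e} {k} {g} {g'} {h} h-irr h^k≋g (e' , h' , h'-irr , k' , _ , h'^k'≋g') h∣g' =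
    ≈ₚ⇒≋ (≡.trans (length-monic g) (≡.sym (length-monic g'))) (begin
      monic g         ≈⟨ ≋⇒≈ₚ h^k≋g ⟨
      monic h ^ₚ k    ≈⟨ ^ₚ-cong k h≈h' ⟩
      monic h' ^ₚ k   ≡⟨ ≡.cong (monic h' ^ₚ_) k≡k' ⟩
      monic h' ^ₚ k'  ≈⟨ ≋⇒≈ₚ h'^k'≋g' ⟩
      monic g'        ∎)
    where
    open import Relation.Binary.Reasoning.Setoid ≈ₚ-setoid
    h≈h' : monic h ≈ₚ monic h'
    h≈h' = irreducible-∣-irreducible h-irr h'-irr (irreducible-∣-^ₚ h-irr (monic h') k'
      (IsIdeal.≈ₚ-closed (∣ₚ-isIdeal (monic h)) (≈ₚ-sym (≋⇒≈ₚ h'^k'≋g')) h∣g'))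
    e≡e' : e ≡ e'
    e≡e' = degree-unique 1≉0 1≉0 (LeadingTerm-cong h≈h' (monic-leadingTerm h)) (monic-leadingTerm h')
    k≡k' : k ≡ k'
    k≡k' = ℕₚ.*-cancelʳ-≡ k k' e {{ℕ.>-nonZero (proj₁ h-irr)}}
      (≡.trans (monic-power-degree {k = k} {h = h} h^k≋g)
        (≡.sym (≡.trans (≡.cong (k' ℕ.*_) e≡e') (monic-power-degree {k = k'} {h = h'} h'^k'≋g'))))

  irreducible-∣-selectedProduct : ∀ {e d} {h : Vec Carrier e} → Irreducible h → (L : List (Vec Carrier d)) →
                                  ∀ t → monic h ∣ₚ selectedProduct L t → Any (λ g → monic h ∣ₚ monic g) L
  irreducible-∣-selectedProduct {h = h} h-irr [] [] h∣1 = ⊥-elim (monic-∤-1 h (proj₁ h-irr) h∣1)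
  irreducible-∣-selectedProduct h-irr (g ∷ L) (inside ∷ t) h∣gP
    with irreducible-prime h-irr (monic g) (selectedProduct L t) h∣gP
  ... | inj₁ h∣g = here h∣g
  ... | inj₂ h∣P = there (irreducible-∣-selectedProduct h-irr L t h∣P)
  irreducible-∣-selectedProduct h-irr (g ∷ L) (outside ∷ t) h∣P = there (irreducible-∣-selectedProduct h-irr L t h∣P)

  Distinct : ∀ {d} → Vec Carrier d → Vec Carrier d → Set (c ⊔ ℓ)
  Distinct g g' = ¬ monic g ≋ monic g'

  primary-∤-selectedProduct : ∀ {d} {g : Vec Carrier d} → Primary g → (L : List (Vec Carrier d)) →
                              All Primary L → All (Distinct g) L → ∀ t → ¬ monic g ∣ₚ selectedProduct L t
  primary-∤-selectedProduct (_ , _ , _ , zero , () , _)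
  primary-∤-selectedProduct {g = g} (e , h , h-irr , suc k , _ , h^k≋g) L primaries distinct t g∣P =
    let (g'-primary , g≠g') , h∣g' = lookupAny (All.zip (primaries , distinct))
                                       (irreducible-∣-selectedProduct h-irr L t (∣ₚ-trans h∣g g∣P))
    in g≠g' (primaries-sharing-factor-≋ {k = suc k} h-irr h^k≋g g'-primary h∣g')
    where
    h∣g : monic h ∣ₚ monic g
    h∣g = IsIdeal.≈ₚ-closed (∣ₚ-isIdeal (monic h)) (≋⇒≈ₚ h^k≋g) (divides (monic h ^ₚ k) ≈ₚ-refl)

  selectedProduct-injective : ∀ {d} (L : List (Vec Carrier d)) → All Primary L → AllPairs Distinct L →
                              ∀ s t → selectedProduct L s ≈ₚ selectedProduct L t → s ≡ t
  selectedProduct-injective [] _ _ [] [] _ = ≡.refl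
  selectedProduct-injective (g ∷ L) (_ ∷ ps) (_ ∷ ds) (inside ∷ s) (inside ∷ t) gP≈gP' =
    ≡.cong (inside ∷_) (selectedProduct-injective L ps ds s t (*ₚ-cancelˡ (monic-NonZeroₚ g) gP≈gP'))
  selectedProduct-injective (g ∷ L) (pg ∷ ps) (dg ∷ ds) (inside ∷ s) (outside ∷ t) gP≈P' =
    ⊥-elim (primary-∤-selectedProduct pg L ps dg t (divides _ (≈ₚ-sym gP≈P')))
  selectedProduct-injective (g ∷ L) (pg ∷ ps) (dg ∷ ds) (outside ∷ s) (inside ∷ t) P≈gP' =
    ⊥-elim (primary-∤-selectedProduct pg L ps dg s (divides _ P≈gP'))
  selectedProduct-injective (g ∷ L) (_ ∷ ps) (_ ∷ ds) (outside ∷ s) (outside ∷ t) P≈P' =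
    ≡.cong (outside ∷_) (selectedProduct-injective L ps ds s t P≈P')

module Evaluation {c ℓ c' ℓ' : Level} (F : CommutativeRing c ℓ) (K : CommutativeRing c' ℓ')
                  (ι : CommutativeRing.Carrier F → CommutativeRing.Carrier K)
                  (ι-hom : RingMorphisms.IsRingHomomorphism (CommutativeRing.rawRing F) (CommutativeRing.rawRing K) ι)
                  where
  open CommutativeRing F hiding (zero)
  open Ext F K ι using (eval)
  open Poly F
  open PolynomialArithmetic F
  open PolynomialIdeals F
  open RingMorphisms.IsRingHomomorphism ι-hom
  module K = CommutativeRing K
  open import Relation.Binary.Reasoning.Setoid K.setoid
  open import Tactic.RingSolver.NonReflective (fromCommutativeRing K (λ _ → nothing))
    using (solve; _⊜_) renaming (_⊕_ to _⊕'_; _⊗_ to _⊗'_)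
  open import Algebra.Properties.Ring K.ring using (-1*x≈-x)

  module _ (x : K.Carrier) where

    eval-[] : ∀ p → p ≈ₚ [] → eval p x K.≈ K.0#
    eval-[] []      _    = K.refl
    eval-[] (a ∷ p) a∷p≈[] = begin
      ι a K.+ x K.* eval p x   ≈⟨ K.+-cong (K.trans (⟦⟧-cong (coeff-≈ a∷p≈[] 0)) 0#-homo)
                                          (K.*-congˡ (eval-[] p (coeffwise λ i → coeff-≈ a∷p≈[] (suc i)))) ⟩
      K.0# K.+ x K.* K.0#      ≈⟨ K.+-identityˡ _ ⟩
      x K.* K.0#               ≈⟨ K.zeroʳ x ⟩
      K.0#                     ∎

    eval-cong : ∀ {p q} → p ≈ₚ q → eval p x K.≈ eval q x
    eval-cong {[]}    {q}     p≈q = K.sym (eval-[] q (≈ₚ-sym p≈q))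
    eval-cong {a ∷ p} {[]}    p≈q = eval-[] (a ∷ p) p≈q
    eval-cong {a ∷ p} {b ∷ q} p≈q =
      K.+-cong (⟦⟧-cong (coeff-≈ p≈q 0)) (K.*-congˡ (eval-cong {p} {q} (coeffwise λ i → coeff-≈ p≈q (suc i))))

    eval-+ₚ : ∀ p q → eval (p +ₚ q) x K.≈ eval p x K.+ eval q x
    eval-+ₚ []      q       = K.sym (K.+-identityˡ _)
    eval-+ₚ (a ∷ p) []      = K.sym (K.+-identityʳ _)
    eval-+ₚ (a ∷ p) (b ∷ q) = begin
      ι (a + b) K.+ x K.* eval (p +ₚ q) x               ≈⟨ K.+-cong (+-homo a b) (K.*-congˡ (eval-+ₚ p q)) ⟩
      (ι a K.+ ι b) K.+ x K.* (eval p x K.+ eval q x)   ≈⟨ regroup (ι a) (ι b) x (eval p x) (eval q x) ⟩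
      (ι a K.+ x K.* eval p x) K.+ (ι b K.+ x K.* eval q x) ∎
      where
      regroup : ∀ a b x u v → (a K.+ b) K.+ x K.* (u K.+ v) K.≈ (a K.+ x K.* u) K.+ (b K.+ x K.* v)
      regroup = solve 5 (λ a b x u v → ((a ⊕' b) ⊕' x ⊗' (u ⊕' v)) ⊜ ((a ⊕' x ⊗' u) ⊕' (b ⊕' x ⊗' v))) K.refl

    eval-scale : ∀ a p → eval (scale a p) x K.≈ ι a K.* eval p x
    eval-scale a []      = K.sym (K.zeroʳ _)
    eval-scale a (b ∷ p) = begin
      ι (a * b) K.+ x K.* eval (scale a p) x     ≈⟨ K.+-cong (*-homo a b) (K.*-congˡ (eval-scale a p)) ⟩
      ι a K.* ι b K.+ x K.* (ι a K.* eval p x)   ≈⟨ factor (ι a) (ι b) x (eval p x) ⟩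
      ι a K.* (ι b K.+ x K.* eval p x)           ∎
      where
      factor : ∀ a b x u → a K.* b K.+ x K.* (a K.* u) K.≈ a K.* (b K.+ x K.* u)
      factor = solve 4 (λ a b x u → (a ⊗' b ⊕' x ⊗' (a ⊗' u)) ⊜ (a ⊗' (b ⊕' x ⊗' u))) K.refl

    eval-*ₚ : ∀ p q → eval (p *ₚ q) x K.≈ eval p x K.* eval q x
    eval-*ₚ []      q = K.sym (K.zeroˡ _)
    eval-*ₚ (a ∷ p) q = begin
      eval (scale a q +ₚ (0# ∷ (p *ₚ q))) x
        ≈⟨ eval-+ₚ (scale a q) (0# ∷ (p *ₚ q)) ⟩
      eval (scale a q) x K.+ (ι 0# K.+ x K.* eval (p *ₚ q) x)
        ≈⟨ K.+-cong (eval-scale a q) (K.trans (K.+-cong 0#-homo (K.*-congˡ (eval-*ₚ p q))) (K.+-identityˡ _)) ⟩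
      ι a K.* eval q x K.+ x K.* (eval p x K.* eval q x)
        ≈⟨ factor (ι a) (eval q x) x (eval p x) ⟩
      (ι a K.+ x K.* eval p x) K.* eval q x ∎
      where
      factor : ∀ a b x u → a K.* b K.+ x K.* (u K.* b) K.≈ (a K.+ x K.* u) K.* b
      factor = solve 4 (λ a b x u → (a ⊗' b ⊕' x ⊗' (u ⊗' b)) ⊜ ((a ⊕' x ⊗' u) ⊗' b)) K.refl

    eval-negₚ : ∀ p → eval (-ₚ p) x K.≈ K.- eval p x
    eval-negₚ p = begin
      eval (-ₚ p) x            ≈⟨ eval-scale (- 1#) p ⟩
      ι (- 1#) K.* eval p x    ≈⟨ K.*-congʳ (K.trans (-‿homo 1#) (K.-‿cong 1#-homo)) ⟩
      K.- K.1# K.* eval p x    ≈⟨ -1*x≈-x _ ⟩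
      K.- eval p x             ∎

    eval≈0-isIdeal : IsIdeal (λ p → eval p x K.≈ K.0#)
    eval≈0-isIdeal = record
      { ≈ₚ-closed = λ p≈q px≈0 → K.trans (K.sym (eval-cong p≈q)) px≈0
      ; +ₚ-closed = λ {p} {q} px≈0 qx≈0 →
          K.trans (eval-+ₚ p q) (K.trans (K.+-cong px≈0 qx≈0) (K.+-identityˡ K.0#))
      ; *ₚ-closed = λ a {p} px≈0 → K.trans (eval-*ₚ a p) (K.trans (K.*-congˡ px≈0) (K.zeroʳ _))
      }

  module OverFields (isField : IsField F) (_≈0? : ∀ a → Dec (a ≈ 0#)) (K-1≉0 : K.1# K.≉ K.0#) where
    open PolynomialsOverField F isField _≈0?
    open IrreduciblePolynomials F isField _≈0?

    ι-≉0 : ∀ {a} → a ≉ 0# → ι a K.≉ K.0#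
    ι-≉0 {a} a≉0 ιa≈0 with proj₂ isField a a≉0
    ... | (a⁻¹ , aa⁻¹≈1) = K-1≉0 (begin
      K.1#              ≈⟨ 1#-homo ⟨
      ι 1#              ≈⟨ ⟦⟧-cong aa⁻¹≈1 ⟨
      ι (a * a⁻¹)       ≈⟨ *-homo a a⁻¹ ⟩
      ι a K.* ι a⁻¹     ≈⟨ K.*-congʳ ιa≈0 ⟩
      K.0# K.* ι a⁻¹    ≈⟨ K.zeroˡ _ ⟩
      K.0#              ∎)

    module _ {n} {f : Vec Carrier n} (f-irr : Irreducible f) {α} (root : eval (monic f) α K.≈ K.0#) where

      eval-≉0 : ∀ {p} → NonZeroₚ p → DegreeBelow n p → eval p α K.≉ K.0#
      eval-≉0 (e , l , l≉0 , L) below pα≈0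
        with lowerDegree⇒nonzeroConstant f-irr (eval≈0-isIdeal α) root l≉0 L (DegreeBelow⇒degree< l≉0 L below) pα≈0
      ... | a , a≉0 , aα≈0 = ι-≉0 a≉0 (begin
        ι a                     ≈⟨ K.+-identityʳ (ι a) ⟨
        ι a K.+ K.0#            ≈⟨ K.+-congˡ (K.zeroʳ α) ⟨
        eval (a ∷ []) α         ≈⟨ aα≈0 ⟩
        K.0#                    ∎)

      eval-injective : ∀ {p q} → DegreeBelow n p → DegreeBelow n q → eval p α K.≈ eval q α → p ≈ₚ q
      eval-injective {p} {q} p-below q-below pα≈qα with ≈ₚ[]⊎NonZeroₚ (p +ₚ (-ₚ q))
      ... | inj₁ p-q≈[] = ≈ₚ-from-difference p-q≈[]
      ... | inj₂ p-q≉0  = ⊥-elim (eval-≉0 p-q≉0 p-q-below (begin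
        eval (p +ₚ (-ₚ q)) α          ≈⟨ eval-+ₚ α p (-ₚ q) ⟩
        eval p α K.+ eval (-ₚ q) α    ≈⟨ K.+-cong pα≈qα (eval-negₚ α q) ⟩
        eval q α K.- eval q α         ≈⟨ K.-‿inverseʳ _ ⟩
        K.0#                          ∎))
        where
        p-q-below : DegreeBelow n (p +ₚ (-ₚ q))
        p-q-below = DegreeBelow-+ₚ {p = p} p-below (DegreeBelow-negₚ {p = q} q-below)

-- Pascal's rule as a definition, so that Fin (binomial m k) splits as k-subsets
-- containing and not containing the first element.
binomial : ℕ → ℕ → ℕ
binomial m       zero    = 1
binomial zero    (suc k) = 0
binomial (suc m) (suc k) = binomial m k ℕ.+ binomial m (suc k)

binomial≡C : ∀ m k → binomial m k ≡ m C k
binomial≡C m       zero    = ≡.refl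
binomial≡C zero    (suc k) = ≡.refl
binomial≡C (suc m) (suc k) =
  ≡.trans (≡.cong₂ ℕ._+_ (binomial≡C m k) (binomial≡C m (suc k))) (nCk+nC[k+1]≡[n+1]C[k+1] m k)

kSubset : ∀ m k → Fin (binomial m k) → Subset m
kSubset m       zero    _ = ⊥
kSubset (suc m) (suc k) i =
  [ (inside ∷_) ∘ kSubset m k , (outside ∷_) ∘ kSubset m (suc k) ]′ (splitAt (binomial m k) i)

∣kSubset∣ : ∀ m k i → ∣ kSubset m k i ∣ ≡ k
∣kSubset∣ m       zero    i = ∣⊥∣≡0 m
∣kSubset∣ (suc m) (suc k) i with splitAt (binomial m k) i
... | inj₁ a = ≡.cong suc (∣kSubset∣ m k a)
... | inj₂ b = ∣kSubset∣ m (suc k) b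

kSubset-injective : ∀ m k {i j} → kSubset m k i ≡ kSubset m k j → i ≡ j
kSubset-injective m       zero    {Fin.zero} {Fin.zero} _ = ≡.refl
kSubset-injective (suc m) (suc k) {i} {j} eq =
  ≡.trans (≡.sym (join-splitAt m₁ m₂ i))
    (≡.trans (≡.cong (join m₁ m₂) (byHead (splitAt m₁ i) (splitAt m₁ j) eq)) (join-splitAt m₁ m₂ j))
  where
  m₁ m₂ : ℕ
  m₁ = binomial m k
  m₂ = binomial m (suc k)
  byHead : ∀ x y → [ (inside ∷_) ∘ kSubset m k , (outside ∷_) ∘ kSubset m (suc k) ]′ x
                 ≡ [ (inside ∷_) ∘ kSubset m k , (outside ∷_) ∘ kSubset m (suc k) ]′ y → x ≡ y
  byHead (inj₁ a) (inj₁ a') eq = ≡.cong inj₁ (kSubset-injective m k (∷-injectiveʳ eq))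
  byHead (inj₂ b) (inj₂ b') eq = ≡.cong inj₂ (kSubset-injective m (suc k) (∷-injectiveʳ eq))
  byHead (inj₁ a) (inj₂ b') eq with () ← ∷-injectiveˡ eq
  byHead (inj₂ b) (inj₁ a') eq with () ← ∷-injectiveˡ eq

tail-injective-on-size : ∀ {m} (S T : Subset (suc m)) → ∣ S ∣ ≡ ∣ T ∣ → Vec.tail S ≡ Vec.tail T → S ≡ T
tail-injective-on-size (inside  ∷ p) (inside  ∷ p) _  ≡.refl = ≡.refl
tail-injective-on-size (outside ∷ p) (outside ∷ p) _  ≡.refl = ≡.refl
tail-injective-on-size (inside  ∷ p) (outside ∷ p) eq ≡.refl with () ← ℕₚ.<-irrefl (≡.sym eq) (ℕₚ.n<1+n _)
tail-injective-on-size (outside ∷ p) (inside  ∷ p) eq ≡.refl with () ← ℕₚ.<-irrefl eq (ℕₚ.n<1+n _)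

∣tail∣≤ : ∀ {m} (S : Subset (suc m)) → ∣ Vec.tail S ∣ ≤ ∣ S ∣
∣tail∣≤ (x ∷ p) = ∣p∣≤∣x∷p∣ x p

pred-ceilDiv*< : ∀ n d → 1 ≤ n → 1 ≤ d → (ceilDiv n d ∸ 1) ℕ.* d < n
pred-ceilDiv*< (suc n) (suc d) _ _ = s≤s (begin
  (q ∸ 1) ℕ.* suc d             ≡⟨ ℕₚ.*-distribʳ-∸ (suc d) q 1 ⟩
  q ℕ.* suc d ∸ 1 ℕ.* suc d     ≤⟨ ℕₚ.∸-monoˡ-≤ (1 ℕ.* suc d) (m/n*n≤m (suc n ℕ.+ d) (suc d)) ⟩
  suc n ℕ.+ d ∸ 1 ℕ.* suc d     ≡⟨ ≡.cong (suc n ℕ.+ d ∸_) (ℕₚ.*-identityˡ (suc d)) ⟩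
  suc n ℕ.+ d ∸ suc d           ≡⟨ ℕₚ.m+n∸n≡m n d ⟩
  n                             ∎)
  where
  open ℕₚ.≤-Reasoning
  q : ℕ
  q = ceilDiv (suc n) (suc d)

HasSize⇒≈? : ∀ {c ℓ} (R : CommutativeRing c ℓ) {m} → HasSize R m → ∀ x y → Dec (CommutativeRing._≈_ R x y)
HasSize⇒≈? R size = via-injection (Inverse⇒Injection size) Fin._≟_

module _ {c ℓ} (S : Setoid c ℓ) where
  open Setoid S

  avoiding-injection⇒≤ : ∀ {m X} → Inverse S (≡.setoid (Fin m)) → ∀ z (v : Fin X → Carrier) →
                         (∀ x → v x ≉ z) → (∀ {x y} → v x ≈ v y → x ≡ y) → X ≤ m ∸ 1
  avoiding-injection⇒≤ {zero}  size z v v≉z v-inj with () ← Inverse.to size z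
  avoiding-injection⇒≤ {suc m} size z v v≉z v-inj = injective⇒≤ {f = squeeze} squeeze-injective
    where
    open Inverse size using (to)
    to-injective : ∀ {x y} → to x ≡ to y → x ≈ y
    to-injective = Injection.injective (Inverse⇒Injection size)
    z≢ : ∀ x → to z ≢ to (v x)
    z≢ x eq = v≉z x (sym (to-injective eq))
    squeeze : _ → Fin m
    squeeze x = punchOut (z≢ x)
    squeeze-injective : ∀ {x y} → squeeze x ≡ squeeze y → x ≡ y
    squeeze-injective {x} {y} eq = v-inj (to-injective (punchOut-injective (z≢ x) (z≢ y) eq))

AllPairs-lookup : ∀ {a r} {A : Set a} {R : A → A → Set r} {xs : List A} → AllPairs R xs →
                  ∀ {i j} → i ≢ j → R (List.lookup xs i) (List.lookup xs j) ⊎ R (List.lookup xs j) (List.lookup xs i)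
AllPairs-lookup (Rx ∷ _)   {Fin.zero}  {Fin.zero}  0≢0 = ⊥-elim (0≢0 ≡.refl)
AllPairs-lookup (Rx ∷ _)   {Fin.zero}  {Fin.suc j} _   = inj₁ (All.lookup Rx (∈-lookup j))
AllPairs-lookup (Rx ∷ _)   {Fin.suc i} {Fin.zero}  _   = inj₂ (All.lookup Rx (∈-lookup i))
AllPairs-lookup (_ ∷ Rxs)  {Fin.suc i} {Fin.suc j} i≢j = AllPairs-lookup Rxs (i≢j ∘ ≡.cong Fin.suc)

module ComponentBound
  {c ℓ c' ℓ' : Level} (F : CommutativeRing c ℓ) (K : CommutativeRing c' ℓ')
  (F-isField : IsField F) (K-isField : IsField K) (q n d : ℕ)
  (F-size : HasSize F q) (K-size : HasSize K (q ℕ.^ n))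
  (ι : CommutativeRing.Carrier F → CommutativeRing.Carrier K)
  (ι-hom : RingMorphisms.IsRingHomomorphism (CommutativeRing.rawRing F) (CommutativeRing.rawRing K) ι)
  (1≤n : 1 ≤ n) (1≤d : 1 ≤ d) (d<n : d < n)
  {f : Vec (CommutativeRing.Carrier F) n} (f-irr : Poly.Irreducible F f)
  {α : CommutativeRing.Carrier K} (root : CommutativeRing._≈_ K (Ext.eval F K ι (Poly.monic F f) α) (CommutativeRing.0# K))
  {Ps : List (Vec (CommutativeRing.Carrier F) d)} (Ps-primary : All (Poly.Primary F) Ps)
  (Ps-distinct : AllPairs (λ u v → ¬ Poly._≋_ F (Poly.monic F u) (Poly.monic F v)) Ps)
  {βs : List (CommutativeRing.Carrier K)} (βs-≉0 : All (λ β → CommutativeRing._≉_ K β (CommutativeRing.0# K)) βs)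
  (βs-disconnected : AllPairs (λ β γ → ¬ Ext.Connected F K ι d α β γ) βs)
  where

  open CommutativeRing F hiding (zero)

  _≈0? : ∀ a → Dec (a ≈ 0#)
  a ≈0? = HasSize⇒≈? F F-size a 0#

  open Poly F
  open PolynomialArithmetic F
  open PolynomialIdeals F
  open PolynomialsOverField F F-isField _≈0?
  open IrreduciblePolynomials F F-isField _≈0?
  open Evaluation F K ι ι-hom
  open Evaluation.OverFields F K ι ι-hom F-isField _≈0? (proj₁ K-isField)
  open Ext F K ι using (eval; Edge; Connected)
  open RingMorphisms.IsRingHomomorphism ι-hom using (1#-homo)
  open FieldProperties F F-isField using () renaming (1≉0 to F-1≉0)
  open FieldProperties K K-isField using () renaming (*-≉0 to K-*-≉0; *-cancelˡ-≉0 to K-*-cancelˡ-≉0)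

  k : ℕ
  k = ceilDiv n d ∸ 1

  E : Subset (length Ps) → K.Carrier
  E s = eval (selectedProduct Ps s) α

  selectedProduct-DegreeBelow : ∀ s → ∣ s ∣ ≤ k → DegreeBelow n (selectedProduct Ps s)
  selectedProduct-DegreeBelow s ∣s∣≤k = degree<⇒DegreeBelow
    (ℕₚ.≤-<-trans (ℕₚ.*-monoˡ-≤ d ∣s∣≤k) (pred-ceilDiv*< n d 1≤n 1≤d)) (selectedProduct-leadingTerm Ps s)

  E-≉0 : ∀ s → ∣ s ∣ ≤ k → E s K.≉ K.0#
  E-≉0 s ∣s∣≤k = eval-≉0 f-irr root (_ , 1# , F-1≉0 , selectedProduct-leadingTerm Ps s)
                                     (selectedProduct-DegreeBelow s ∣s∣≤k)

  E-injective : ∀ s t → ∣ s ∣ ≤ k → ∣ t ∣ ≤ k → E s K.≈ E t → s ≡ t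
  E-injective s t ∣s∣≤k ∣t∣≤k Es≈Et = selectedProduct-injective Ps Ps-primary Ps-distinct s t
    (eval-injective f-irr root (selectedProduct-DegreeBelow s ∣s∣≤k) (selectedProduct-DegreeBelow t ∣t∣≤k) Es≈Et)

  ≈⇒Connected : ∀ {β γ} → β K.≈ γ → Connected d α β γ
  ≈⇒Connected β≈γ = fwd (inj₂ β≈γ) ◅ ε

  connected-selectedProduct : ∀ (L : List (Vec Carrier d)) → All Primary L → ∀ s {β} → β K.≉ K.0# →
                              Connected d α β (β K.* eval (selectedProduct L s) α)
  connected-selectedProduct [] [] [] {β} _ = ≈⇒Connected (K.sym (begin
    β K.* (ι 1# K.+ α K.* K.0#)   ≈⟨ K.*-congˡ (K.trans (K.+-cong 1#-homo (K.zeroʳ α)) (K.+-identityʳ K.1#)) ⟩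
    β K.* K.1#                   ≈⟨ K.*-identityʳ β ⟩
    β                            ∎))
    where open import Relation.Binary.Reasoning.Setoid K.setoid
  connected-selectedProduct (g ∷ L) (_ ∷ ps) (outside ∷ s) β≉0 = connected-selectedProduct L ps s β≉0
  connected-selectedProduct (g ∷ L) (g-primary ∷ ps) (inside ∷ s) {β} β≉0 =
    fwd (inj₁ (β≉0 , βg≉0 , g , g-primary , K.refl)) ◅
    (connected-selectedProduct L ps s βg≉0 ◅◅ ≈⇒Connected (begin
      β K.* eval (monic g) α K.* eval P α   ≈⟨ K.*-assoc _ _ _ ⟩
      β K.* (eval (monic g) α K.* eval P α) ≈⟨ K.*-congˡ (eval-*ₚ α (monic g) P) ⟨
      β K.* eval (monic g *ₚ P) α           ∎))
    where
    open import Relation.Binary.Reasoning.Setoid K.setoid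
    P : Pol
    P = selectedProduct L s
    βg≉0 : β K.* eval (monic g) α K.≉ K.0#
    βg≉0 = K-*-≉0 β≉0 (eval-≉0 f-irr root (monic-NonZeroₚ g) (degree<⇒DegreeBelow d<n (monic-leadingTerm g)))

  M : ℕ
  M = binomial (suc (length Ps)) k

  -- Dropping a dummy first element turns a k-subset of p + 1 elements into a subset of Ps of
  -- size at most k: this is where the binomial coefficient C(p + 1, k) comes from.
  subsetOf : Fin M → Subset (length Ps)
  subsetOf j = Vec.tail (kSubset (suc (length Ps)) k j)

  ∣subsetOf∣≤k : ∀ j → ∣ subsetOf j ∣ ≤ k
  ∣subsetOf∣≤k j = ℕₚ.≤-trans (∣tail∣≤ (kSubset _ k j)) (ℕₚ.≤-reflexive (∣kSubset∣ _ k j))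

  subsetOf-injective : ∀ {j j'} → subsetOf j ≡ subsetOf j' → j ≡ j'
  subsetOf-injective {j} {j'} eq = kSubset-injective _ k
    (tail-injective-on-size _ _ (≡.trans (∣kSubset∣ _ k j) (≡.sym (∣kSubset∣ _ k j'))) eq)

  N : ℕ
  N = length βs

  β : Fin N → K.Carrier
  β = List.lookup βs

  β-≉0 : ∀ i → β i K.≉ K.0#
  β-≉0 i = All.lookup βs-≉0 (∈-lookup i)

  point : Fin N × Fin M → K.Carrier
  point (i , j) = β i K.* E (subsetOf j)

  point-≉0 : ∀ x → point x K.≉ K.0#
  point-≉0 (i , j) = K-*-≉0 (β-≉0 i) (E-≉0 (subsetOf j) (∣subsetOf∣≤k j))

  point-injective : ∀ {x y} → point x K.≈ point y → x ≡ y
  point-injective {i , j} {i' , j'} eq with i Fin.≟ i'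
  ... | no i≢i' = ⊥-elim ([ (λ ¬c → ¬c βi~βi') , (λ ¬c → ¬c (EqClosure.symmetric _ βi~βi')) ]′
                           (AllPairs-lookup βs-disconnected i≢i'))
    where
    βi~βi' : Connected d α (β i) (β i')
    βi~βi' = connected-selectedProduct Ps Ps-primary (subsetOf j) (β-≉0 i) ◅◅ (≈⇒Connected eq ◅◅
             EqClosure.symmetric _ (connected-selectedProduct Ps Ps-primary (subsetOf j') (β-≉0 i')))
  ... | yes ≡.refl = ≡.cong (i ,_) (subsetOf-injective
          (E-injective _ _ (∣subsetOf∣≤k j) (∣subsetOf∣≤k j') (K-*-cancelˡ-≉0 (β-≉0 i) eq)))

  components*binomial≤ : N ℕ.* M ≤ q ℕ.^ n ∸ 1
  components*binomial≤ = avoiding-injection⇒≤ K.setoid K-size K.0# (point ∘ remQuot {N} M) (point-≉0 ∘ remQuot {N} M)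
    λ {x} {y} eq → ≡.trans (≡.sym (combine-remQuot {N} M x))
                     (≡.trans (≡.cong (uncurry combine) (point-injective eq)) (combine-remQuot {N} M y))

open import Data.Nat using (_*_; _+_; _^_)

theorem14 : {c ℓ c' ℓ' : Level} (F : CommutativeRing c ℓ) (K : CommutativeRing c' ℓ') →
    IsField F → IsField K →
    (q n d : ℕ) → HasSize F q → HasSize K (q ^ n) →
    (ι : CommutativeRing.Carrier F → CommutativeRing.Carrier K) →
    RingMorphisms.IsRingHomomorphism (CommutativeRing.rawRing F) (CommutativeRing.rawRing K) ι →
    1 < n → 1 ≤ d → d < n →
    (α : CommutativeRing.Carrier K) → Ext.RootOfIrreducible F K ι n α →
    (p N : ℕ) → Poly.CardP F d p → Ext.NumComponents F K ι d α N →
    N * ((p + 1) C (ceilDiv n d ∸ 1)) ≤ q ^ n ∸ 1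
theorem14 F K F-isField K-isField q n d F-size K-size ι ι-hom 1<n 1≤d d<n α (f , f-irr , root) _ _
          (Ps , ≡.refl , Ps-primary , Ps-distinct , _) (βs , ≡.refl , βs-≉0 , βs-disconnected , _) =
  ≡.subst (λ m → length βs * m ≤ q ^ n ∸ 1) binomial≡C-p+1 components*binomial≤
  where
  open ComponentBound F K F-isField K-isField q n d F-size K-size ι ι-hom (ℕₚ.<⇒≤ 1<n) 1≤d d<n
         f-irr root Ps-primary Ps-distinct βs-≉0 βs-disconnected
  binomial≡C-p+1 : binomial (suc (length Ps)) k ≡ (length Ps + 1) C k
  binomial≡C-p+1 = ≡.trans (binomial≡C (suc (length Ps)) k) (≡.cong (_C k) (ℕₚ.+-comm 1 (length Ps)))
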